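{- Let $L$ be an even lattice of rank $m\ge 3$ such that $L=L_1\oplus U(N)$ for some even lattice $L_1$ of rank $m-2$ and nonzero integer $N$, and put $k=m/2$. Let $p$ be a prime, $\nu\in\mathbb{Z}_{\ge0}$, $\gamma\in L'$ and $n\in\mathbb{Z}-Q(\gamma)$, and let $\nu_N=\mathrm{ord}_p(N)$. Then either $N^L_{\gamma,n}(p^\nu)=0$ or \[p^{\nu(1-2k)}N^L_{\gamma,n}(p^\nu)\ge p^{(3-2k)\nu_N}(1-1/p).\]
   Context: $U(N)$ denotes $\mathbb{Z}^2$ with quadratic form $Q(x,y)=Nxy$. For an even lattice $L$ with quadratic form $Q$, $\gamma\in L'$ (the dual lattice), $n\in\mathbb{Z}-Q(\gamma)$ and a positive integer $a$, the representation number is $N^L_{\gamma,n}(a)=\#\{r\in L/aL: Q(r-\gamma)+n\equiv0\pmod a\}$. -}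

module Defs where

open import Data.Nat as ℕ using (ℕ; zero; suc)
open import Data.Nat.Properties using (m^n≢0)
open import Data.Nat.Divisibility using (_∣_; _∣?_)
open import Data.Integer as ℤ using (ℤ; +_; -[1+_])
open import Data.Rational as ℚ using (ℚ; _/_; ↥_; ↧ₙ_; 0ℚ; 1ℚ; ½)
open import Data.Fin using (Fin; zero; suc; toℕ; splitAt)
open import Data.Fin.Base using (_↑ˡ_)
open import Data.List using (List; []; _∷_; map; concatMap; length; filterᵇ)
open import Data.List.Base using (allFin)
open import Data.Sum using (inj₁; inj₂)
open import Data.Product using (∃; _×_)
open import Data.Bool using (Bool; _∧_)
open import Relation.Nullary using (¬_)
open import Relation.Nullary.Decidable using (⌊_⌋)
open import Relation.Binary.PropositionalEquality using (_≡_)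

sumFin : ∀ {n} → (Fin n → ℚ) → ℚ
sumFin {zero}  f = 0ℚ
sumFin {suc n} f = f zero ℚ.+ sumFin (λ i → f (suc i))

ℤ→ℚ : ℤ → ℚ
ℤ→ℚ z = z / 1

embedℤ : ∀ {m} → (Fin m → ℤ) → (Fin m → ℚ)
embedℤ x i = ℤ→ℚ (x i)

embedFin : ∀ {m a} → (Fin m → Fin a) → (Fin m → ℚ)
embedFin r i = ℤ→ℚ (+ toℕ (r i))

_-ᵥ_ : ∀ {m} → (Fin m → ℚ) → (Fin m → ℚ) → (Fin m → ℚ)
(x -ᵥ y) i = x i ℚ.- y i

-- Lattices: ℤ^m with a symmetric integral Gram matrix G, bilinear form
-- B(x,y) = xᵀ G y and quadratic form Q(x) = B(x,x)/2 (extended to ℚ^m).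

Gram : ℕ → Set
Gram m = Fin m → Fin m → ℤ

bil : ∀ {m} → Gram m → (Fin m → ℚ) → (Fin m → ℚ) → ℚ
bil G x y = sumFin (λ i → sumFin (λ j → ℤ→ℚ (G i j) ℚ.* x i ℚ.* y j))

Qform : ∀ {m} → Gram m → (Fin m → ℚ) → ℚ
Qform G x = ½ ℚ.* bil G x x

IsInt : ℚ → Set
IsInt q = ∃ λ (z : ℤ) → q ≡ ℤ→ℚ z

record IsEvenLattice {m : ℕ} (G : Gram m) : Set where
  field
    symmetric   : ∀ i j → G i j ≡ G j i
    evenDiag    : ∀ i → ∃ λ (z : ℤ) → G i i ≡ (+ 2) ℤ.* z
    nondegenerate : ∀ (x : Fin m → ℤ) →
      (∀ i → sumFin (λ j → ℤ→ℚ (G i j) ℚ.* embedℤ x j) ≡ 0ℚ) → ∀ i → x i ≡ + 0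

gramU : ℤ → Gram 2
gramU N zero zero = + 0
gramU N zero (suc zero) = N
gramU N (suc zero) zero = N
gramU N (suc zero) (suc zero) = + 0

gramSum : ∀ {m₁} → Gram m₁ → ℤ → Gram (m₁ ℕ.+ 2)
gramSum {m₁} G N i j with splitAt m₁ i | splitAt m₁ j
... | inj₁ a | inj₁ b = G a b
... | inj₂ a | inj₂ b = gramU N a b
... | inj₁ _ | inj₂ _ = + 0
... | inj₂ _ | inj₁ _ = + 0

InDual : ∀ {m} → Gram m → (Fin m → ℚ) → Set
InDual G γ = ∀ (x : Fin _ → ℤ) → IsInt (bil G γ (embedℤ x))

-- "q ≡ 0 (mod a)" for a rational q: q is an integer divisible by a
zeroMod : ℕ → ℚ → Bool
zeroMod a q = ⌊ ↧ₙ q ℕ.≟ 1 ⌋ ∧ ⌊ a ∣? ℤ.∣ ↥ q ∣ ⌋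

consF : ∀ {m a} → Fin a → (Fin m → Fin a) → (Fin (suc m) → Fin a)
consF x v zero = x
consF x v (suc i) = v i

-- all of (ℤ/aℤ)^m ≅ L/aL, via representatives with coordinates 0,…,a-1
allVecs : ∀ m a → List (Fin m → Fin a)
allVecs zero a = (λ ()) ∷ []
allVecs (suc m) a = concatMap (λ x → map (consF x) (allVecs m a)) (allFin a)

repNum : ∀ {m} → Gram m → (Fin m → ℚ) → ℚ → ℕ → ℕ
repNum {m} G γ n a =
  length (filterᵇ (λ r → zeroMod a (Qform G (embedFin r -ᵥ γ) ℚ.+ n)) (allVecs m a))

IsOrd : ℕ → ℤ → ℕ → Set
IsOrd p N ν = (p ℕ.^ ν) ∣ ℤ.∣ N ∣ × ¬ ((p ℕ.^ suc ν) ∣ ℤ.∣ N ∣)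

-- p^e ∈ ℚ for e ∈ ℤ (p = 0 gets a junk value; only used for primes p)
powℤ : ℕ → ℤ → ℚ
powℤ zero e = 0ℚ
powℤ (suc p) (+ e) = (+ (suc p ℕ.^ e)) / 1
powℤ (suc p) -[1+ e ] = (+ 1) / (suc p ℕ.^ suc e)
  where instance _ = m^n≢0 (suc p) (suc e)

module Submission where

-- Fix a solution r₀ = (w₀, x₀, y₀) modulo p^ν, put s = x - x₀, t = y - y₀ and move the
-- L₁-coordinates as w = w₀ + p^ℓ u. Expanding Q(r - γ) + n, the congruence becomes
-- c + s B₁ + t B₂ + N s t ≡ 0 (mod p^ν), where B₁, B₂ pair r₀ - γ with the hyperbolic basis
-- of U(N) and p^ℓ ∣ c. For fixed x this is linear in y, so it has p^d solutions when the
-- coefficient B₂ + N s has p-adic order d ≤ ν and p^d divides the constant term.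
-- Comparing the orders of B₁ and B₂ with e = min(ord_p N, ν) gives some ℓ ≤ e and at least
-- K ≥ p^(ν+ℓ-1) (p-1) pairs (x, y) for each of the p^((ν-ℓ)(m-2)) admissible w;
-- collecting exponents gives the bound.

open import Defs
open import Data.Nat
  using (ℕ; zero; suc; pred; _+_; _*_; _∸_; _^_; _≤_; _<_; _⊓_; z≤n; s≤s; NonZero)
import Data.Nat.Properties as ℕP
import Data.Nat.Divisibility as ℕ∣
open import Data.Nat.Coprimality as Coprime using (Coprime)
open import Data.Nat.GCD using (module Bézout)
open import Data.Nat.Primality
  using (Prime; prime⇒nonZero; prime⇒irreducible; ¬prime[0]; ¬prime[1])
open import Data.Nat.Solver using (module +-*-Solver)
open import Data.Integer as ℤ using (ℤ; +_; -[1+_])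
import Data.Integer.Properties as ℤP
open import Data.Integer.Divisibility.Signed as ℤ∣ using (divides)
open import Data.Integer.Solver renaming (module +-*-Solver to ℤ-Solver)
open import Data.Rational as ℚ using (ℚ; 0ℚ; 1ℚ; ½; mkℚ)
import Data.Rational.Properties as ℚP
open import Data.Rational.Solver renaming (module +-*-Solver to ℚ-Solver)
open import Data.Rational.Unnormalised as ℚᵘ using (mkℚᵘ)
import Data.Rational.Unnormalised.Properties as ℚᵘP
open import Data.Bool using (Bool; true; false; not)
open import Data.Fin using (Fin; zero; suc; toℕ; splitAt; _↑ˡ_; _↑ʳ_)
import Data.Fin.Properties as FinP
open import Data.List using (List; []; _∷_; _++_; map; concatMap; length; filterᵇ; tabulate)
open import Data.Product using (∃; _×_; _,_; proj₁; proj₂)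
open import Data.Sum using (_⊎_; inj₁; inj₂)
open import Data.Empty using (⊥-elim)
open import Function using (_∘_)
import Data.Vec.Functional as V
import Data.Vec.Functional.Properties as VP
open import Relation.Binary.Definitions using (tri<; tri≈; tri>)
open import Relation.Binary.PropositionalEquality
open import Relation.Nullary using (¬_; yes; no)
open import Relation.Nullary.Decidable using (⌊_⌋)

module _ where
  open ℚ-Solver

  sumFin-cong : ∀ {m} {f g : Fin m → ℚ} → (∀ i → f i ≡ g i) → sumFin f ≡ sumFin g
  sumFin-cong {zero}  h = refl
  sumFin-cong {suc m} h = cong₂ ℚ._+_ (h zero) (sumFin-cong (h ∘ suc))

  sumFin-+ : ∀ {m} (f g : Fin m → ℚ) →
    sumFin (λ i → f i ℚ.+ g i) ≡ sumFin f ℚ.+ sumFin g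
  sumFin-+ {zero}  f g = refl
  sumFin-+ {suc m} f g = trans (cong (f zero ℚ.+ g zero ℚ.+_) (sumFin-+ (f ∘ suc) (g ∘ suc)))
    (solve 4 (λ a b c d → (a :+ b) :+ (c :+ d) := (a :+ c) :+ (b :+ d)) refl
      (f zero) (g zero) (sumFin (f ∘ suc)) (sumFin (g ∘ suc)))

  sumFin-*ˡ : ∀ {m} c (f : Fin m → ℚ) → sumFin (λ i → c ℚ.* f i) ≡ c ℚ.* sumFin f
  sumFin-*ˡ {zero}  c f = sym (ℚP.*-zeroʳ c)
  sumFin-*ˡ {suc m} c f = trans (cong (c ℚ.* f zero ℚ.+_) (sumFin-*ˡ c (f ∘ suc)))
    (sym (ℚP.*-distribˡ-+ c (f zero) _))

  sumFin-zero : ∀ {m} (f : Fin m → ℚ) → (∀ i → f i ≡ 0ℚ) → sumFin f ≡ 0ℚ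
  sumFin-zero {zero}  f h = refl
  sumFin-zero {suc m} f h = cong₂ ℚ._+_ (h zero) (sumFin-zero (f ∘ suc) (h ∘ suc))

  sumFin-comm : ∀ {m k} (f : Fin m → Fin k → ℚ) →
    sumFin (λ i → sumFin (f i)) ≡ sumFin (λ j → sumFin (λ i → f i j))
  sumFin-comm {zero} {k} f = sym (sumFin-zero {k} _ (λ _ → refl))
  sumFin-comm {suc m} f = trans (cong (sumFin (f zero) ℚ.+_) (sumFin-comm (f ∘ suc)))
    (sym (sumFin-+ (f zero) (λ j → sumFin (λ i → f (suc i) j))))

  sumFin-↑ : ∀ {m} k (f : Fin (m + k) → ℚ) →
    sumFin f ≡ sumFin (λ i → f (i ↑ˡ k)) ℚ.+ sumFin (λ i → f (m ↑ʳ i))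
  sumFin-↑ {zero}  k f = sym (ℚP.+-identityˡ _)
  sumFin-↑ {suc m} k f = trans (cong (f zero ℚ.+_) (sumFin-↑ k (f ∘ suc)))
    (sym (ℚP.+-assoc (f zero) _ _))

sumFin² : ∀ {m k} → (Fin m → Fin k → ℚ) → ℚ
sumFin² F = sumFin (λ i → sumFin (F i))

sumFin²-cong : ∀ {m k} {F H : Fin m → Fin k → ℚ} → (∀ i j → F i j ≡ H i j) →
  sumFin² F ≡ sumFin² H
sumFin²-cong h = sumFin-cong (sumFin-cong ∘ h)

sumFin²-+ : ∀ {m k} (F H : Fin m → Fin k → ℚ) →
  sumFin² (λ i j → F i j ℚ.+ H i j) ≡ sumFin² F ℚ.+ sumFin² H
sumFin²-+ F H = trans (sumFin-cong (λ i → sumFin-+ (F i) (H i)))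
  (sumFin-+ (sumFin ∘ F) (sumFin ∘ H))

sumFin²-*ˡ : ∀ {m k} c (F : Fin m → Fin k → ℚ) →
  sumFin² (λ i j → c ℚ.* F i j) ≡ c ℚ.* sumFin² F
sumFin²-*ˡ c F = trans (sumFin-cong (λ i → sumFin-*ˡ c (F i))) (sumFin-*ˡ c (sumFin ∘ F))

sumFin²-zero : ∀ {m k} (F : Fin m → Fin k → ℚ) → (∀ i j → F i j ≡ 0ℚ) → sumFin² F ≡ 0ℚ
sumFin²-zero {m} F h = trans (sumFin-cong (λ i → sumFin-zero (F i) (h i))) (sumFin-zero {m} _ (λ _ → refl))

sumFin²-↑ : ∀ {m} k (F : Fin (m + k) → Fin (m + k) → ℚ) →
  sumFin² F ≡ (sumFin² (λ a b → F (a ↑ˡ k) (b ↑ˡ k)) ℚ.+ sumFin² (λ a b → F (a ↑ˡ k) (m ↑ʳ b)))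
           ℚ.+ (sumFin² (λ a b → F (m ↑ʳ a) (b ↑ˡ k)) ℚ.+ sumFin² (λ a b → F (m ↑ʳ a) (m ↑ʳ b)))
sumFin²-↑ {m} k F = trans (sumFin-↑ k (sumFin ∘ F)) (cong₂ ℚ._+_ (half (_↑ˡ k)) (half (m ↑ʳ_)))
  where
  half : ∀ {l} (ι : Fin l → Fin (m + k)) → sumFin (λ a → sumFin (F (ι a))) ≡
    sumFin² (λ a b → F (ι a) (b ↑ˡ k)) ℚ.+ sumFin² (λ a b → F (ι a) (m ↑ʳ b))
  half ι = trans (sumFin-cong (λ a → sumFin-↑ k (F (ι a))))
    (sumFin-+ (λ a → sumFin (λ b → F (ι a) (b ↑ˡ k))) (λ a → sumFin (λ b → F (ι a) (m ↑ʳ b))))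

module _ {m} (G : Gram m) where
  open ℚ-Solver

  private
    g : Fin m → Fin m → ℚ
    g i j = ℤ→ℚ (G i j)

    F : (Fin m → ℚ) → (Fin m → ℚ) → Fin m → Fin m → ℚ
    F u v i j = g i j ℚ.* u i ℚ.* v j

  bil-cong : ∀ {x y x′ y′} → (∀ i → x i ≡ x′ i) → (∀ i → y i ≡ y′ i) →
    bil G x y ≡ bil G x′ y′
  bil-cong hx hy = sumFin²-cong (λ i j → cong₂ (λ u v → g i j ℚ.* u ℚ.* v) (hx i) (hy j))

  Qform-cong : ∀ {x y} → (∀ i → x i ≡ y i) → Qform G x ≡ Qform G y
  Qform-cong h = cong (½ ℚ.*_) (bil-cong h h)

  bil-sym : (∀ i j → G i j ≡ G j i) → ∀ x y → bil G x y ≡ bil G y x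
  bil-sym sym-G x y = trans (sumFin-comm (λ i j → g i j ℚ.* x i ℚ.* y j)) (sumFin²-cong λ j i →
    trans (cong (λ z → ℤ→ℚ z ℚ.* x i ℚ.* y j) (sym-G i j))
      (solve 3 (λ a u v → a :* u :* v := a :* v :* u) refl (g j i) (x i) (y j)))

  bil-linearʳ : ∀ x c v d w →
    bil G x (λ j → c ℚ.* v j ℚ.+ d ℚ.* w j) ≡ c ℚ.* bil G x v ℚ.+ d ℚ.* bil G x w
  bil-linearʳ x c v d w = begin
    sumFin² (λ i j → g i j ℚ.* x i ℚ.* (c ℚ.* v j ℚ.+ d ℚ.* w j))
      ≡⟨ sumFin²-cong (λ i j → solve 6 (λ a u c v d w →
           a :* u :* (c :* v :+ d :* w) := c :* (a :* u :* v) :+ d :* (a :* u :* w))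
           refl (g i j) (x i) c (v j) d (w j)) ⟩
    sumFin² (λ i j → c ℚ.* (g i j ℚ.* x i ℚ.* v j) ℚ.+ d ℚ.* (g i j ℚ.* x i ℚ.* w j))
      ≡⟨ sumFin²-+ {m} {m} _ _ ⟩
    sumFin² (λ i j → c ℚ.* (g i j ℚ.* x i ℚ.* v j)) ℚ.+ sumFin² (λ i j → d ℚ.* (g i j ℚ.* x i ℚ.* w j))
      ≡⟨ cong₂ ℚ._+_ (sumFin²-*ˡ {m} {m} c _) (sumFin²-*ˡ {m} {m} d _) ⟩
    c ℚ.* bil G x v ℚ.+ d ℚ.* bil G x w ∎
    where open ≡-Reasoning

  bil-subˡ : ∀ x y z → bil G (λ i → x i ℚ.- y i) z ≡ bil G x z ℚ.- bil G y z
  bil-subˡ x y z = begin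
    sumFin² (λ i j → g i j ℚ.* (x i ℚ.- y i) ℚ.* z j)
      ≡⟨ sumFin²-cong (λ i j → solve 4 (λ a u v w →
           a :* (u :- v) :* w := a :* u :* w :+ con (ℚ.- 1ℚ) :* (a :* v :* w))
           refl (g i j) (x i) (y i) (z j)) ⟩
    sumFin² (λ i j → g i j ℚ.* x i ℚ.* z j ℚ.+ (ℚ.- 1ℚ) ℚ.* (g i j ℚ.* y i ℚ.* z j))
      ≡⟨ trans (sumFin²-+ {m} {m} _ _) (cong (bil G x z ℚ.+_) (sumFin²-*ˡ (ℚ.- 1ℚ) (F y z))) ⟩
    bil G x z ℚ.+ (ℚ.- 1ℚ) ℚ.* bil G y z
      ≡⟨ solve 2 (λ a b → a :+ con (ℚ.- 1ℚ) :* b := a :- b) refl (bil G x z) (bil G y z) ⟩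
    bil G x z ℚ.- bil G y z ∎
    where open ≡-Reasoning

  Qform-+ : (∀ i j → G i j ≡ G j i) → ∀ x y →
    Qform G (λ i → x i ℚ.+ y i) ≡ Qform G x ℚ.+ bil G x y ℚ.+ Qform G y
  Qform-+ sym-G x y = begin
    ½ ℚ.* sumFin² (λ i j → g i j ℚ.* (x i ℚ.+ y i) ℚ.* (x j ℚ.+ y j))
      ≡⟨ cong (½ ℚ.*_) (sumFin²-cong (λ i j → solve 5 (λ a u u′ v v′ →
           a :* (u :+ v) :* (u′ :+ v′) := ((a :* u :* u′ :+ a :* u :* v′) :+ a :* v :* u′) :+ a :* v :* v′)
           refl (g i j) (x i) (x j) (y i) (y j))) ⟩
    ½ ℚ.* sumFin² (λ i j → ((F x x i j ℚ.+ F x y i j) ℚ.+ F y x i j) ℚ.+ F y y i j)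
      ≡⟨ cong (½ ℚ.*_) (trans (sumFin²-+ _ (F y y)) (cong (ℚ._+ bil G y y)
           (trans (sumFin²-+ _ (F y x)) (cong (ℚ._+ bil G y x) (sumFin²-+ (F x x) (F x y)))))) ⟩
    ½ ℚ.* (((bil G x x ℚ.+ bil G x y) ℚ.+ bil G y x) ℚ.+ bil G y y)
      ≡⟨ cong (λ z → ½ ℚ.* (((bil G x x ℚ.+ bil G x y) ℚ.+ z) ℚ.+ bil G y y)) (bil-sym sym-G y x) ⟩
    ½ ℚ.* (((bil G x x ℚ.+ bil G x y) ℚ.+ bil G x y) ℚ.+ bil G y y)
      ≡⟨ solve 3 (λ a b c → con ½ :* (((a :+ b) :+ b) :+ c) := con ½ :* a :+ b :+ con ½ :* c)
           refl (bil G x x) (bil G x y) (bil G y y) ⟩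
    Qform G x ℚ.+ bil G x y ℚ.+ Qform G y ∎
    where open ≡-Reasoning

  Qform-*ˡ : ∀ c x → Qform G (λ i → c ℚ.* x i) ≡ (c ℚ.* c) ℚ.* Qform G x
  Qform-*ˡ c x = begin
    ½ ℚ.* sumFin² (λ i j → g i j ℚ.* (c ℚ.* x i) ℚ.* (c ℚ.* x j))
      ≡⟨ cong (½ ℚ.*_) (sumFin²-cong (λ i j → solve 4 (λ a c u v →
           a :* (c :* u) :* (c :* v) := (c :* c) :* (a :* u :* v)) refl (g i j) c (x i) (x j))) ⟩
    ½ ℚ.* sumFin² (λ i j → (c ℚ.* c) ℚ.* (g i j ℚ.* x i ℚ.* x j))
      ≡⟨ cong (½ ℚ.*_) (sumFin²-*ˡ (c ℚ.* c) (F x x)) ⟩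
    ½ ℚ.* ((c ℚ.* c) ℚ.* bil G x x)
      ≡⟨ solve 3 (λ h d b → h :* (d :* b) := d :* (h :* b)) refl ½ (c ℚ.* c) (bil G x x) ⟩
    (c ℚ.* c) ℚ.* Qform G x ∎
    where open ≡-Reasoning

ℤ→ℚ-mkℚ : ∀ z → ℤ→ℚ z ≡ mkℚ z 0 (Coprime.sym (Coprime.1-coprimeTo ℤ.∣ z ∣))
ℤ→ℚ-mkℚ z = ℚP.↥p/↧p≡p (mkℚ z 0 (Coprime.sym (Coprime.1-coprimeTo ℤ.∣ z ∣)))

ℤ→ℚ-+ : ∀ a b → ℤ→ℚ (a ℤ.+ b) ≡ ℤ→ℚ a ℚ.+ ℤ→ℚ b
ℤ→ℚ-+ a b rewrite ℤ→ℚ-mkℚ a | ℤ→ℚ-mkℚ b =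
  cong ℤ→ℚ (sym (cong₂ ℤ._+_ (ℤP.*-identityʳ a) (ℤP.*-identityʳ b)))

ℤ→ℚ-* : ∀ a b → ℤ→ℚ (a ℤ.* b) ≡ ℤ→ℚ a ℚ.* ℤ→ℚ b
ℤ→ℚ-* a b rewrite ℤ→ℚ-mkℚ a | ℤ→ℚ-mkℚ b = refl

ℤ→ℚ-neg : ∀ a → ℤ→ℚ (ℤ.- a) ≡ ℚ.- ℤ→ℚ a
ℤ→ℚ-neg a rewrite ℤ→ℚ-mkℚ a | ℤ→ℚ-mkℚ (ℤ.- a) with a
... | + zero    = refl
... | + suc n   = refl
... | -[1+ n ]  = refl

ℤ→ℚ-- : ∀ a b → ℤ→ℚ (a ℤ.- b) ≡ ℤ→ℚ a ℚ.- ℤ→ℚ b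
ℤ→ℚ-- a b = trans (ℤ→ℚ-+ a (ℤ.- b)) (cong (ℤ→ℚ a ℚ.+_) (ℤ→ℚ-neg b))

ℤ→ℚ-moved : ∀ a b d g → a ℤ.- b ≡ d → ℤ→ℚ a ℚ.- g ≡ (ℤ→ℚ b ℚ.- g) ℚ.+ ℤ→ℚ d
ℤ→ℚ-moved a b d g refl = begin
  ℤ→ℚ a ℚ.- g
    ≡⟨ cong (λ z → ℤ→ℚ z ℚ.- g) (ℤ-Solver.solve 2 (λ a b →
         a ℤ-Solver.:= b ℤ-Solver.:+ (a ℤ-Solver.:- b)) refl a b) ⟩
  ℤ→ℚ (b ℤ.+ (a ℤ.- b)) ℚ.- g
    ≡⟨ cong (ℚ._- g) (ℤ→ℚ-+ b (a ℤ.- b)) ⟩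
  (ℤ→ℚ b ℚ.+ ℤ→ℚ (a ℤ.- b)) ℚ.- g
    ≡⟨ ℚ-Solver.solve 3 (λ b d g →
         (b ℚ-Solver.:+ d) ℚ-Solver.:- g ℚ-Solver.:= (b ℚ-Solver.:- g) ℚ-Solver.:+ d)
         refl (ℤ→ℚ b) (ℤ→ℚ (a ℤ.- b)) g ⟩
  (ℤ→ℚ b ℚ.- g) ℚ.+ ℤ→ℚ (a ℤ.- b) ∎
  where open ≡-Reasoning

isInt-+ : ∀ {x y} → IsInt x → IsInt y → IsInt (x ℚ.+ y)
isInt-+ (a , refl) (b , refl) = a ℤ.+ b , sym (ℤ→ℚ-+ a b)

isInt-* : ∀ {x y} → IsInt x → IsInt y → IsInt (x ℚ.* y)
isInt-* (a , refl) (b , refl) = a ℤ.* b , sym (ℤ→ℚ-* a b)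

isInt-- : ∀ {x y} → IsInt x → IsInt y → IsInt (x ℚ.- y)
isInt-- (a , refl) (b , refl) = a ℤ.- b , sym (ℤ→ℚ-- a b)

isInt-ℤ→ℚ : ∀ z → IsInt (ℤ→ℚ z)
isInt-ℤ→ℚ z = z , refl

isInt-resp : ∀ {x y} → x ≡ y → IsInt x → IsInt y
isInt-resp refl h = h

isInt-sumFin : ∀ {m} (f : Fin m → ℚ) → (∀ i → IsInt (f i)) → IsInt (sumFin f)
isInt-sumFin {zero}  f h = + 0 , refl
isInt-sumFin {suc m} f h = isInt-+ (h zero) (isInt-sumFin (f ∘ suc) (h ∘ suc))

isInt-sumFin² : ∀ {m k} (H : Fin m → Fin k → ℤ) (x : Fin m → ℚ) (y : Fin k → ℚ) →
  (∀ i → IsInt (x i)) → (∀ j → IsInt (y j)) →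
  IsInt (sumFin² (λ i j → ℤ→ℚ (H i j) ℚ.* x i ℚ.* y j))
isInt-sumFin² H x y hx hy =
  isInt-sumFin _ (λ i → isInt-sumFin _ (λ j → isInt-* (isInt-* (isInt-ℤ→ℚ (H i j)) (hx i)) (hy j)))

module _ {m} (G : Gram m) (sym-G : ∀ i j → G i j ≡ G j i)
         (even-G : ∀ i → ∃ λ (z : ℤ) → G i i ≡ + 2 ℤ.* z) where

  -- G = H + Hᵀ, so that Q(x) = xᵀ H x has integer coefficients.
  private
    H : Fin m → Fin m → ℤ
    H i j with FinP.<-cmp i j
    ... | tri< _ _ _ = G i j
    ... | tri≈ _ _ _ = proj₁ (even-G i)
    ... | tri> _ _ _ = + 0

    G≡H+Hᵀ : ∀ i j → G i j ≡ H i j ℤ.+ H j i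
    G≡H+Hᵀ i j with FinP.<-cmp i j | FinP.<-cmp j i
    ... | tri< _ _ _    | tri> _ _ _    = sym (ℤP.+-identityʳ _)
    ... | tri> _ _ _    | tri< _ _ _    = trans (sym-G i j) (sym (ℤP.+-identityˡ _))
    ... | tri≈ _ refl _ | tri≈ _ _ _    = trans (proj₂ (even-G i))
      (ℤ-Solver.solve 1 (λ z → ℤ-Solver.con (+ 2) ℤ-Solver.:* z ℤ-Solver.:= z ℤ-Solver.:+ z)
        refl (proj₁ (even-G i)))
    ... | tri< _ i≢j _  | tri≈ _ j≡i _  = ⊥-elim (i≢j (sym j≡i))
    ... | tri< i<j _ _  | tri< j<i _ _  = ⊥-elim (FinP.<-asym i<j j<i)
    ... | tri> _ i≢j _  | tri≈ _ j≡i _  = ⊥-elim (i≢j (sym j≡i))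
    ... | tri> _ _ j<i  | tri> _ _ i<j  = ⊥-elim (FinP.<-asym i<j j<i)
    ... | tri≈ _ i≡j _  | tri< _ j≢i _  = ⊥-elim (j≢i (sym i≡j))
    ... | tri≈ _ i≡j _  | tri> _ j≢i _  = ⊥-elim (j≢i (sym i≡j))

    T : (Fin m → ℚ) → ℚ
    T x = sumFin² (λ i j → ℤ→ℚ (H i j) ℚ.* x i ℚ.* x j)

    bil≡T+T : ∀ x → bil G x x ≡ T x ℚ.+ T x
    bil≡T+T x = begin
      sumFin² (λ i j → ℤ→ℚ (G i j) ℚ.* x i ℚ.* x j)
        ≡⟨ sumFin²-cong (λ i j → trans
             (cong (λ z → ℤ→ℚ z ℚ.* x i ℚ.* x j) (trans (G≡H+Hᵀ i j) (ℤP.+-comm (H i j) (H j i))))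
             (trans (cong (λ z → z ℚ.* x i ℚ.* x j) (ℤ→ℚ-+ (H j i) (H i j)))
               (solve 4 (λ a b u v → (a :+ b) :* u :* v := b :* u :* v :+ a :* v :* u)
                 refl (ℤ→ℚ (H j i)) (ℤ→ℚ (H i j)) (x i) (x j)))) ⟩
      sumFin² (λ i j → ℤ→ℚ (H i j) ℚ.* x i ℚ.* x j ℚ.+ ℤ→ℚ (H j i) ℚ.* x j ℚ.* x i)
        ≡⟨ sumFin²-+ {m} {m} _ _ ⟩
      T x ℚ.+ sumFin² (λ i j → ℤ→ℚ (H j i) ℚ.* x j ℚ.* x i)
        ≡⟨ cong (T x ℚ.+_) (sym (sumFin-comm (λ i j → ℤ→ℚ (H i j) ℚ.* x i ℚ.* x j))) ⟩
      T x ℚ.+ T x ∎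
      where
      open ≡-Reasoning
      open ℚ-Solver

  Qform-isInt : ∀ x → (∀ i → IsInt (x i)) → IsInt (Qform G x)
  Qform-isInt x hx = isInt-resp (sym Q≡T) (isInt-sumFin² H x x hx hx)
    where
    open ℚ-Solver
    Q≡T : Qform G x ≡ T x
    Q≡T = trans (cong (½ ℚ.*_) (bil≡T+T x))
      (solve 1 (λ t → con ½ :* (t :+ t) := t) refl (T x))

0ᵥ : ∀ {k} → Fin k → ℚ
0ᵥ _ = 0ℚ

module DirectSum {m₁} (G₁ : Gram m₁) (N : ℤ) where
  open ℚ-Solver

  G : Gram (m₁ + 2)
  G = gramSum G₁ N

  gramSum-sym : (∀ i j → G₁ i j ≡ G₁ j i) → ∀ i j → G i j ≡ G j i
  gramSum-sym sym-G₁ i j with splitAt m₁ i | splitAt m₁ j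
  ... | inj₁ a | inj₁ b = sym-G₁ a b
  ... | inj₁ a | inj₂ b = refl
  ... | inj₂ a | inj₁ b = refl
  ... | inj₂ zero | inj₂ zero = refl
  ... | inj₂ zero | inj₂ (suc zero) = refl
  ... | inj₂ (suc zero) | inj₂ zero = refl
  ... | inj₂ (suc zero) | inj₂ (suc zero) = refl

  gramSum-even : (∀ i → ∃ λ (z : ℤ) → G₁ i i ≡ + 2 ℤ.* z) →
    ∀ i → ∃ λ (z : ℤ) → G i i ≡ + 2 ℤ.* z
  gramSum-even even-G₁ i with splitAt m₁ i
  ... | inj₁ a = even-G₁ a
  ... | inj₂ zero = + 0 , refl
  ... | inj₂ (suc zero) = + 0 , refl

  bil-⊥ : ∀ f g → bil G (f V.++ 0ᵥ {2}) (0ᵥ {m₁} V.++ g) ≡ 0ℚ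
  bil-⊥ f g = sumFin²-zero _ term≡0
    where
    term≡0 : ∀ i j → ℤ→ℚ (G i j) ℚ.* (f V.++ 0ᵥ {2}) i ℚ.* (0ᵥ {m₁} V.++ g) j ≡ 0ℚ
    term≡0 i j with splitAt m₁ i | splitAt m₁ j
    ... | inj₁ a | inj₁ b = ℚP.*-zeroʳ (ℤ→ℚ (G₁ a b) ℚ.* f a)
    ... | inj₁ a | inj₂ b = trans (cong (ℚ._* g b) (ℚP.*-zeroˡ (f a))) (ℚP.*-zeroˡ (g b))
    ... | inj₂ a | inj₁ b = refl
    ... | inj₂ a | inj₂ b = trans (cong (ℚ._* g b) (ℚP.*-zeroʳ (ℤ→ℚ (gramU N a b)))) (ℚP.*-zeroˡ (g b))

  e₁ e₂ : Fin (m₁ + 2) → ℚ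
  e₁ = 0ᵥ {m₁} V.++ (1ℚ V.∷ 0ℚ V.∷ V.[])
  e₂ = 0ᵥ {m₁} V.++ (0ℚ V.∷ 1ℚ V.∷ V.[])

  Qform-hyperbolic : ∀ s t → Qform G (0ᵥ {m₁} V.++ (s V.∷ t V.∷ V.[])) ≡ ℤ→ℚ N ℚ.* s ℚ.* t
  Qform-hyperbolic s t = trans (cong (½ ℚ.*_) (trans (sumFin²-↑ 2 F)
      (cong₂ ℚ._+_ (cong₂ ℚ._+_ (sumFin²-zero _ (λ a b → F-L₁ˡ a (b ↑ˡ 2)))
                                (sumFin²-zero _ (λ a b → F-L₁ˡ a (m₁ ↑ʳ b))))
                   (cong₂ ℚ._+_ (sumFin²-zero _ (λ a b → F-L₁ʳ (m₁ ↑ʳ a) b))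
                                (sumFin²-cong F-U)))))
      (solve 3 (λ n s t → con ½ :* ((con 0ℚ :+ con 0ℚ) :+ (con 0ℚ :+
        ((con 0ℚ :* s :* s :+ (n :* s :* t :+ con 0ℚ)) :+
         ((n :* t :* s :+ (con 0ℚ :* t :* t :+ con 0ℚ)) :+ con 0ℚ)))) := n :* s :* t)
        refl (ℤ→ℚ N) s t)
    where
    w : Fin (m₁ + 2) → ℚ
    w = 0ᵥ {m₁} V.++ (s V.∷ t V.∷ V.[])
    F : Fin (m₁ + 2) → Fin (m₁ + 2) → ℚ
    F i j = ℤ→ℚ (G i j) ℚ.* w i ℚ.* w j
    F-L₁ˡ : ∀ a j → F (a ↑ˡ 2) j ≡ 0ℚ
    F-L₁ˡ a j rewrite VP.lookup-++ˡ (0ᵥ {m₁}) (s V.∷ t V.∷ V.[]) a =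
      trans (cong (ℚ._* w j) (ℚP.*-zeroʳ (ℤ→ℚ (G (a ↑ˡ 2) j)))) (ℚP.*-zeroˡ (w j))
    F-L₁ʳ : ∀ i b → F i (b ↑ˡ 2) ≡ 0ℚ
    F-L₁ʳ i b rewrite VP.lookup-++ˡ (0ᵥ {m₁}) (s V.∷ t V.∷ V.[]) b = ℚP.*-zeroʳ (ℤ→ℚ (G i (b ↑ˡ 2)) ℚ.* w i)
    F-U : ∀ a b → F (m₁ ↑ʳ a) (m₁ ↑ʳ b) ≡
      ℤ→ℚ (gramU N a b) ℚ.* (s V.∷ t V.∷ V.[]) a ℚ.* (s V.∷ t V.∷ V.[]) b
    F-U a b rewrite FinP.splitAt-↑ʳ m₁ 2 a | FinP.splitAt-↑ʳ m₁ 2 b = refl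

  shift : (P : ℚ) (u : Fin m₁ → ℚ) (s t : ℚ) → Fin (m₁ + 2) → ℚ
  shift P u s t = (λ k → P ℚ.* u k) V.++ (s V.∷ t V.∷ V.[])

  module _ (sym-G₁ : ∀ i j → G₁ i j ≡ G₁ j i)
           (A : Fin (m₁ + 2) → ℚ) (P : ℚ) (u : Fin m₁ → ℚ) (s t : ℚ) where

    private
      sym-G = gramSum-sym sym-G₁
      U W Δ : Fin (m₁ + 2) → ℚ
      U = u V.++ 0ᵥ {2}
      W = 0ᵥ {m₁} V.++ (s V.∷ t V.∷ V.[])
      Δ = shift P u s t

      Δ≡PU+W : ∀ i → Δ i ≡ P ℚ.* U i ℚ.+ 1ℚ ℚ.* W i
      Δ≡PU+W i with splitAt m₁ i
      ... | inj₁ k = solve 2 (λ a b → a := a :+ con 1ℚ :* con 0ℚ) refl (P ℚ.* u k) 0ℚ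
      ... | inj₂ b = solve 2 (λ p c → c := p :* con 0ℚ :+ con 1ℚ :* c) refl P ((s V.∷ t V.∷ V.[]) b)

      W≡se₁+te₂ : ∀ i → W i ≡ s ℚ.* e₁ i ℚ.+ t ℚ.* e₂ i
      W≡se₁+te₂ i with splitAt m₁ i
      ... | inj₁ k = solve 2 (λ s t → con 0ℚ := s :* con 0ℚ :+ t :* con 0ℚ) refl s t
      ... | inj₂ zero = solve 2 (λ s t → s := s :* con 1ℚ :+ t :* con 0ℚ) refl s t
      ... | inj₂ (suc zero) = solve 2 (λ s t → t := s :* con 0ℚ :+ t :* con 1ℚ) refl s t

      PU≡ : ∀ i → P ℚ.* U i ≡ ((λ k → P ℚ.* u k) V.++ 0ᵥ {2}) i
      PU≡ i with splitAt m₁ i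
      ... | inj₁ k = refl
      ... | inj₂ b = ℚP.*-zeroʳ P

      Qform-Δ : Qform G Δ ≡ (P ℚ.* P) ℚ.* Qform G U ℚ.+ ℤ→ℚ N ℚ.* s ℚ.* t
      Qform-Δ = begin
        Qform G Δ
          ≡⟨ Qform-cong G (λ i → trans (Δ≡PU+W i) (cong (P ℚ.* U i ℚ.+_) (ℚP.*-identityˡ (W i)))) ⟩
        Qform G (λ i → P ℚ.* U i ℚ.+ W i)
          ≡⟨ Qform-+ G sym-G (λ i → P ℚ.* U i) W ⟩
        Qform G (λ i → P ℚ.* U i) ℚ.+ bil G (λ i → P ℚ.* U i) W ℚ.+ Qform G W
          ≡⟨ cong₂ (λ a b → a ℚ.+ b ℚ.+ Qform G W) (Qform-*ˡ G P U)
               (trans (bil-cong G PU≡ (λ _ → refl)) (bil-⊥ (λ k → P ℚ.* u k) (s V.∷ t V.∷ V.[]))) ⟩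
        (P ℚ.* P) ℚ.* Qform G U ℚ.+ 0ℚ ℚ.+ Qform G W
          ≡⟨ cong₂ ℚ._+_ (ℚP.+-identityʳ ((P ℚ.* P) ℚ.* Qform G U)) (Qform-hyperbolic s t) ⟩
        (P ℚ.* P) ℚ.* Qform G U ℚ.+ ℤ→ℚ N ℚ.* s ℚ.* t ∎
        where open ≡-Reasoning

      bil-Δ : bil G A Δ ≡ P ℚ.* bil G A U ℚ.+ (s ℚ.* bil G A e₁ ℚ.+ t ℚ.* bil G A e₂)
      bil-Δ = begin
        bil G A Δ
          ≡⟨ bil-cong G (λ _ → refl) Δ≡PU+W ⟩
        bil G A (λ i → P ℚ.* U i ℚ.+ 1ℚ ℚ.* W i)
          ≡⟨ bil-linearʳ G A P U 1ℚ W ⟩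
        P ℚ.* bil G A U ℚ.+ 1ℚ ℚ.* bil G A W
          ≡⟨ cong (P ℚ.* bil G A U ℚ.+_) (trans (ℚP.*-identityˡ _)
               (trans (bil-cong G (λ _ → refl) W≡se₁+te₂) (bil-linearʳ G A s e₁ t e₂))) ⟩
        P ℚ.* bil G A U ℚ.+ (s ℚ.* bil G A e₁ ℚ.+ t ℚ.* bil G A e₂) ∎
        where open ≡-Reasoning

    Qform-+-shift : Qform G (λ i → A i ℚ.+ shift P u s t i) ≡
      Qform G A ℚ.+ P ℚ.* bil G A (u V.++ 0ᵥ {2}) ℚ.+ (P ℚ.* P) ℚ.* Qform G (u V.++ 0ᵥ {2})
        ℚ.+ s ℚ.* bil G A e₁ ℚ.+ t ℚ.* bil G A e₂ ℚ.+ ℤ→ℚ N ℚ.* s ℚ.* t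
    Qform-+-shift = begin
      Qform G (λ i → A i ℚ.+ Δ i)
        ≡⟨ Qform-+ G sym-G A Δ ⟩
      Qform G A ℚ.+ bil G A Δ ℚ.+ Qform G Δ
        ≡⟨ cong₂ (λ a b → Qform G A ℚ.+ a ℚ.+ b) bil-Δ Qform-Δ ⟩
      Qform G A ℚ.+ (P ℚ.* bil G A U ℚ.+ (s ℚ.* bil G A e₁ ℚ.+ t ℚ.* bil G A e₂))
        ℚ.+ ((P ℚ.* P) ℚ.* Qform G U ℚ.+ ℤ→ℚ N ℚ.* s ℚ.* t)
        ≡⟨ solve 10 (λ QA P BU PP QU s B₁ t B₂ n →
             QA :+ (P :* BU :+ (s :* B₁ :+ t :* B₂)) :+ (PP :* QU :+ n :* s :* t)
             := QA :+ P :* BU :+ PP :* QU :+ s :* B₁ :+ t :* B₂ :+ n :* s :* t) refl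
             (Qform G A) P (bil G A U) (P ℚ.* P) (Qform G U) s (bil G A e₁) t (bil G A e₂) (ℤ→ℚ N) ⟩
      Qform G A ℚ.+ P ℚ.* bil G A U ℚ.+ (P ℚ.* P) ℚ.* Qform G U
        ℚ.+ s ℚ.* bil G A e₁ ℚ.+ t ℚ.* bil G A e₂ ℚ.+ ℤ→ℚ N ℚ.* s ℚ.* t ∎
      where open ≡-Reasoning

  embedFin-++≡+shift : ∀ {q} (r₀ : Fin (m₁ + 2) → Fin q) (w : Fin m₁ → Fin q) (x y : Fin q)
    (γ : Fin (m₁ + 2) → ℚ) (P : ℤ) (u : Fin m₁ → ℤ) →
    (∀ k → + toℕ (w k) ℤ.- + toℕ (r₀ (k ↑ˡ 2)) ≡ P ℤ.* u k) →
    ∀ i → (embedFin (w V.++ (x V.∷ y V.∷ V.[])) -ᵥ γ) i ≡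
      (embedFin r₀ -ᵥ γ) i ℚ.+ shift (ℤ→ℚ P) (ℤ→ℚ ∘ u)
        (ℤ→ℚ (+ toℕ x ℤ.- + toℕ (r₀ (m₁ ↑ʳ zero)))) (ℤ→ℚ (+ toℕ y ℤ.- + toℕ (r₀ (m₁ ↑ʳ suc zero)))) i
  embedFin-++≡+shift r₀ w x y γ P u w≡ i with splitAt m₁ i in i≡
  ... | inj₁ k = trans (ℤ→ℚ-moved (+ toℕ (w k)) (+ toℕ (r₀ i)) (P ℤ.* u k) (γ i)
          (trans (cong (λ r → + toℕ (w k) ℤ.- + toℕ r) (cong r₀ (sym (FinP.splitAt⁻¹-↑ˡ i≡)))) (w≡ k)))
      (cong ((embedFin r₀ -ᵥ γ) i ℚ.+_) (ℤ→ℚ-* P (u k)))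
  ... | inj₂ zero = ℤ→ℚ-moved (+ toℕ x) (+ toℕ (r₀ i)) _ (γ i)
          (cong (λ r → + toℕ x ℤ.- + toℕ r) (cong r₀ (sym (FinP.splitAt⁻¹-↑ʳ i≡))))
  ... | inj₂ (suc zero) = ℤ→ℚ-moved (+ toℕ y) (+ toℕ (r₀ i)) _ (γ i)
          (cong (λ r → + toℕ y ℤ.- + toℕ r) (cong r₀ (sym (FinP.splitAt⁻¹-↑ʳ i≡))))

𝟙 : Bool → ℕ
𝟙 true  = 1
𝟙 false = 0

𝟙-positive : ∀ {b} → 0 < 𝟙 b → b ≡ true
𝟙-positive {true} _ = refl

sumFinℕ : ∀ a → (Fin a → ℕ) → ℕ
sumFinℕ zero    f = 0
sumFinℕ (suc a) f = f zero + sumFinℕ a (f ∘ suc)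

sumRange : ℕ → (ℕ → ℕ) → ℕ
sumRange zero    f = 0
sumRange (suc n) f = f 0 + sumRange n (f ∘ suc)

sumFinℕ-toℕ : ∀ a (f : ℕ → ℕ) → sumFinℕ a (f ∘ toℕ) ≡ sumRange a f
sumFinℕ-toℕ zero    f = refl
sumFinℕ-toℕ (suc a) f = cong (λ s → f 0 + s) (sumFinℕ-toℕ a (f ∘ suc))

sumFinℕ-cong : ∀ {a} {f g : Fin a → ℕ} → (∀ i → f i ≡ g i) → sumFinℕ a f ≡ sumFinℕ a g
sumFinℕ-cong {zero}  h = refl
sumFinℕ-cong {suc a} h = cong₂ _+_ (h zero) (sumFinℕ-cong (h ∘ suc))

sumFinℕ-*ˡ : ∀ {a} c (f : Fin a → ℕ) → sumFinℕ a (λ x → c * f x) ≡ c * sumFinℕ a f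
sumFinℕ-*ˡ {zero}  c f = sym (ℕP.*-zeroʳ c)
sumFinℕ-*ˡ {suc a} c f = trans (cong (λ s → c * f zero + s) (sumFinℕ-*ˡ c (f ∘ suc)))
  (sym (ℕP.*-distribˡ-+ c (f zero) _))

sumFinℕ-mono : ∀ {a} {f g : Fin a → ℕ} → (∀ i → f i ≤ g i) → sumFinℕ a f ≤ sumFinℕ a g
sumFinℕ-mono {zero}  h = z≤n
sumFinℕ-mono {suc a} h = ℕP.+-mono-≤ (h zero) (sumFinℕ-mono (h ∘ suc))

sumFinℕ-positive : ∀ {a} (f : Fin a → ℕ) → 0 < sumFinℕ a f → ∃ λ x → 0 < f x
sumFinℕ-positive {suc a} f h with f zero in eq
... | suc _ = zero , subst (0 <_) (sym eq) (s≤s z≤n)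
... | zero with sumFinℕ-positive (f ∘ suc) h
...   | x , fx>0 = suc x , fx>0

sumVec : ∀ m a → ((Fin m → Fin a) → ℕ) → ℕ
sumVec zero    a f = f (λ ())
sumVec (suc m) a f = sumFinℕ a (λ x → sumVec m a (f ∘ consF x))

Extensional : ∀ {m a} {B : Set} → ((Fin m → Fin a) → B) → Set
Extensional f = ∀ v v′ → (∀ i → v i ≡ v′ i) → f v ≡ f v′

consF-cong : ∀ {m a} (x : Fin a) {v v′ : Fin m → Fin a} →
  (∀ i → v i ≡ v′ i) → ∀ i → consF x v i ≡ consF x v′ i
consF-cong x h zero    = refl
consF-cong x h (suc i) = h i

sumVec-cong : ∀ {m a} {f g : (Fin m → Fin a) → ℕ} → (∀ v → f v ≡ g v) →
  sumVec m a f ≡ sumVec m a g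
sumVec-cong {zero}  h = h _
sumVec-cong {suc m} h = sumFinℕ-cong (λ x → sumVec-cong (h ∘ consF x))

countᵇ : ∀ {A : Set} → (A → Bool) → List A → ℕ
countᵇ P xs = length (filterᵇ P xs)

private
  countᵇ-[_] : ∀ {A : Set} (P : A → Bool) v → countᵇ P (v ∷ []) ≡ 𝟙 (P v)
  countᵇ-[ P ] v with P v
  ... | true  = refl
  ... | false = refl

  countᵇ-++ : ∀ {A : Set} (P : A → Bool) xs ys → countᵇ P (xs ++ ys) ≡ countᵇ P xs + countᵇ P ys
  countᵇ-++ P []       ys = refl
  countᵇ-++ P (x ∷ xs) ys with P x
  ... | true  = cong suc (countᵇ-++ P xs ys)
  ... | false = countᵇ-++ P xs ys

  countᵇ-map : ∀ {A B : Set} (P : B → Bool) (h : A → B) xs → countᵇ P (map h xs) ≡ countᵇ (P ∘ h) xs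
  countᵇ-map P h []       = refl
  countᵇ-map P h (x ∷ xs) with P (h x)
  ... | true  = cong suc (countᵇ-map P h xs)
  ... | false = countᵇ-map P h xs

  countᵇ-concatMap : ∀ {A B : Set} {a} (P : B → Bool) (g : A → List B) (k : Fin a → A) →
    countᵇ P (concatMap g (tabulate k)) ≡ sumFinℕ a (λ x → countᵇ P (g (k x)))
  countᵇ-concatMap {a = zero}  P g k = refl
  countᵇ-concatMap {a = suc a} P g k = trans (countᵇ-++ P (g (k zero)) _)
    (cong (λ s → countᵇ P (g (k zero)) + s) (countᵇ-concatMap P g (k ∘ suc)))

countᵇ-allVecs : ∀ m a (P : (Fin m → Fin a) → Bool) → Extensional P →
  countᵇ P (allVecs m a) ≡ sumVec m a (𝟙 ∘ P)
countᵇ-allVecs zero    a P ext = trans (countᵇ-[ P ] _) (cong 𝟙 (ext _ _ (λ ())))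
countᵇ-allVecs (suc m) a P ext = trans (countᵇ-concatMap P (λ x → map (consF x) (allVecs m a)) (λ x → x))
  (sumFinℕ-cong (λ x → trans (countᵇ-map P (consF x) (allVecs m a))
    (countᵇ-allVecs m a (P ∘ consF x) (λ v v′ h → ext _ _ (consF-cong x h)))))

sumVec-positive : ∀ {m a} (f : (Fin m → Fin a) → ℕ) → 0 < sumVec m a f → ∃ λ v → 0 < f v
sumVec-positive {zero}  f h = (λ ()) , h
sumVec-positive {suc m} f h with sumFinℕ-positive _ h
... | x , hx with sumVec-positive (f ∘ consF x) hx
...   | v , hv = consF x v , hv

sumVec-++ : ∀ k j a (f : (Fin (k + j) → Fin a) → ℕ) → Extensional f →
  sumVec (k + j) a f ≡ sumVec k a (λ w → sumVec j a (λ z → f (w V.++ z)))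
sumVec-++ zero    j a f ext = sumVec-cong {j} {a} (λ z → ext _ _ (λ i → refl))
sumVec-++ (suc k) j a f ext = sumFinℕ-cong (λ x →
  trans (sumVec-++ k j a (f ∘ consF x) (λ v v′ h → ext _ _ (consF-cong x h)))
        (sumVec-cong (λ w → sumVec-cong (λ z → ext _ _ (consF-++ x w z)))))
  where
  consF-++ : ∀ x (w : Fin k → Fin a) (z : Fin j → Fin a) i →
    consF x (w V.++ z) i ≡ (consF x w V.++ z) i
  consF-++ x w z zero = refl
  consF-++ x w z (suc i) with splitAt k i
  ... | inj₁ _ = refl
  ... | inj₂ _ = refl

sumVec-≥ : ∀ k a M K (C : Fin k → Fin a → Bool) (f : (Fin k → Fin a) → ℕ) →
  (∀ i → M ≤ sumFinℕ a (𝟙 ∘ C i)) → (∀ w → (∀ i → C i (w i) ≡ true) → K ≤ f w) →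
  M ^ k * K ≤ sumVec k a f
sumVec-≥ zero    a M K C f hC hf = subst (_≤ f (λ ())) (sym (ℕP.+-identityʳ K)) (hf _ (λ ()))
sumVec-≥ (suc k) a M K C f hC hf = begin
  M * M ^ k * K                              ≡⟨ ℕP.*-assoc M (M ^ k) K ⟩
  M * (M ^ k * K)                            ≤⟨ ℕP.*-monoˡ-≤ (M ^ k * K) (hC zero) ⟩
  sumFinℕ a (𝟙 ∘ C zero) * (M ^ k * K)      ≡⟨ ℕP.*-comm (sumFinℕ a (𝟙 ∘ C zero)) _ ⟩
  M ^ k * K * sumFinℕ a (𝟙 ∘ C zero)        ≡⟨ sym (sumFinℕ-*ˡ {a} (M ^ k * K) _) ⟩
  sumFinℕ a (λ x → M ^ k * K * 𝟙 (C zero x)) ≤⟨ sumFinℕ-mono column ⟩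
  sumVec (suc k) a f                         ∎
  where
  open ℕP.≤-Reasoning
  column : ∀ x → M ^ k * K * 𝟙 (C zero x) ≤ sumVec k a (f ∘ consF x)
  column x with C zero x in eq
  ... | false = subst (_≤ sumVec k a (f ∘ consF x)) (sym (ℕP.*-zeroʳ (M ^ k * K))) z≤n
  ... | true  = subst (_≤ sumVec k a (f ∘ consF x)) (sym (ℕP.*-identityʳ (M ^ k * K)))
    (sumVec-≥ k a M K (C ∘ suc) (f ∘ consF x) (hC ∘ suc)
      (λ w hw → hf (consF x w) λ { zero → eq ; (suc i) → hw i }))

sumRange-cong : ∀ n {f g : ℕ → ℕ} → (∀ i → f i ≡ g i) → sumRange n f ≡ sumRange n g
sumRange-cong zero    h = refl
sumRange-cong (suc n) h = cong₂ _+_ (h 0) (sumRange-cong n (h ∘ suc))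

sumRange-+ : ∀ a b (f : ℕ → ℕ) → sumRange (a + b) f ≡ sumRange a f + sumRange b (λ i → f (a + i))
sumRange-+ zero    b f = refl
sumRange-+ (suc a) b f = trans (cong (λ s → f 0 + s) (sumRange-+ a b (f ∘ suc))) (sym (ℕP.+-assoc (f 0) _ _))

sumRange-suc : ∀ a (f : ℕ → ℕ) → sumRange (suc a) f ≡ sumRange a f + f a
sumRange-suc a f = begin
  sumRange (suc a) f               ≡⟨ cong (λ n → sumRange n f) (ℕP.+-comm 1 a) ⟩
  sumRange (a + 1) f               ≡⟨ sumRange-+ a 1 f ⟩
  sumRange a f + (f (a + 0) + 0)   ≡⟨ cong (λ s → sumRange a f + s)
                                        (trans (ℕP.+-identityʳ _) (cong f (ℕP.+-identityʳ a))) ⟩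
  sumRange a f + f a               ∎
  where open ≡-Reasoning

sumRange-zero : ∀ n (f : ℕ → ℕ) → (∀ i → i < n → f i ≡ 0) → sumRange n f ≡ 0
sumRange-zero zero    f h = refl
sumRange-zero (suc n) f h = cong₂ _+_ (h 0 (s≤s z≤n)) (sumRange-zero n (f ∘ suc) (λ i i<n → h (suc i) (s≤s i<n)))

sumRange-const : ∀ n c → sumRange n (λ _ → c) ≡ n * c
sumRange-const zero    c = refl
sumRange-const (suc n) c = cong (λ s → c + s) (sumRange-const n c)

sumRange-mono : ∀ n {f g : ℕ → ℕ} → (∀ i → f i ≤ g i) → sumRange n f ≤ sumRange n g
sumRange-mono zero    h = z≤n
sumRange-mono (suc n) h = ℕP.+-mono-≤ (h 0) (sumRange-mono n (h ∘ suc))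

sumRange-*ˡ : ∀ n c (f : ℕ → ℕ) → sumRange n (λ i → c * f i) ≡ c * sumRange n f
sumRange-*ˡ zero    c f = sym (ℕP.*-zeroʳ c)
sumRange-*ˡ (suc n) c f = trans (cong (λ s → c * f 0 + s) (sumRange-*ˡ n c (f ∘ suc)))
  (sym (ℕP.*-distribˡ-+ c (f 0) _))

sumRange-distrib-+ : ∀ n (f g : ℕ → ℕ) →
  sumRange n (λ i → f i + g i) ≡ sumRange n f + sumRange n g
sumRange-distrib-+ zero    f g = refl
sumRange-distrib-+ (suc n) f g = trans (cong (λ s → f 0 + g 0 + s) (sumRange-distrib-+ n (f ∘ suc) (g ∘ suc)))
  (+-*-Solver.solve 4 (λ a b c d → (a :+ b) :+ (c :+ d) := (a :+ c) :+ (b :+ d)) refl (f 0) (g 0) _ _)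
  where open +-*-Solver

sumRange-comm : ∀ n m (f : ℕ → ℕ → ℕ) →
  sumRange n (λ x → sumRange m (f x)) ≡ sumRange m (λ y → sumRange n (λ x → f x y))
sumRange-comm zero    m f = sym (sumRange-zero m _ (λ _ _ → refl))
sumRange-comm (suc n) m f = trans (cong (λ s → sumRange m (f 0) + s) (sumRange-comm n m (f ∘ suc)))
  (sym (sumRange-distrib-+ m (f 0) (λ y → sumRange n (λ x → f (suc x) y))))

infix 5 _∣ᵇ_

_∣ᵇ_ : ℕ → ℤ → Bool
D ∣ᵇ z = ⌊ + D ℤ∣.∣? z ⌋

∣ᵇ-complete : ∀ {D z} → + D ℤ∣.∣ z → D ∣ᵇ z ≡ true
∣ᵇ-complete {D} {z} D∣z with + D ℤ∣.∣? z
... | yes _  = refl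
... | no D∤z = ⊥-elim (D∤z D∣z)

∣ᵇ-sound : ∀ {D z} → D ∣ᵇ z ≡ true → + D ℤ∣.∣ z
∣ᵇ-sound {D} {z} h with + D ℤ∣.∣? z
... | yes D∣z = D∣z

∣ᵇ-false : ∀ {D z} → ¬ + D ℤ∣.∣ z → D ∣ᵇ z ≡ false
∣ᵇ-false {D} {z} D∤z with + D ℤ∣.∣? z
... | yes D∣z = ⊥-elim (D∤z D∣z)
... | no _    = refl

∣ᵇ-cong : ∀ {D D′ z z′} → (+ D ℤ∣.∣ z → + D′ ℤ∣.∣ z′) → (+ D′ ℤ∣.∣ z′ → + D ℤ∣.∣ z) →
  D ∣ᵇ z ≡ D′ ∣ᵇ z′
∣ᵇ-cong {D} {D′} {z} {z′} to from with + D ℤ∣.∣? z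
... | yes D∣z = sym (∣ᵇ-complete (to D∣z))
... | no D∤z  = sym (∣ᵇ-false (D∤z ∘ from))

zeroMod-ℤ→ℚ : ∀ a z → zeroMod a (ℤ→ℚ z) ≡ a ∣ᵇ z
zeroMod-ℤ→ℚ a z rewrite ℤ→ℚ-mkℚ z with a ℕ∣.∣? ℤ.∣ z ∣ | + a ℤ∣.∣? z
... | yes _ | yes _ = refl
... | no _  | no _  = refl
... | yes a∣z | no a∤z = ⊥-elim (a∤z (ℤ∣.∣ᵤ⇒∣ a∣z))
... | no a∤z | yes a∣z = ⊥-elim (a∤z (ℤ∣.∣⇒∣ᵤ a∣z))

zeroMod-sound : ∀ a x → zeroMod a x ≡ true → ∃ λ z → x ≡ ℤ→ℚ z × + a ℤ∣.∣ z
zeroMod-sound a (mkℚ z zero _) h = z , sym (ℤ→ℚ-mkℚ z) , ℤ∣.∣ᵤ⇒∣ (divides-of h)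
  where
  divides-of : ⌊ a ℕ∣.∣? ℤ.∣ z ∣ ⌋ ≡ true → a ℕ∣.∣ ℤ.∣ z ∣
  divides-of h with a ℕ∣.∣? ℤ.∣ z ∣
  ... | yes a∣z = a∣z

module _ (D-1 : ℕ) where
  private
    D = suc D-1

    window : ℤ → ℕ
    window c = sumRange D (λ x → 𝟙 (D ∣ᵇ (+ x ℤ.+ c)))

    window-suc : ∀ c → window (c ℤ.+ + 1) ≡ window c
    window-suc c = ℕP.+-cancelˡ-≡ (𝟙 (D ∣ᵇ c)) _ _ (begin
      𝟙 (D ∣ᵇ c) + window (c ℤ.+ + 1)
        ≡⟨ cong₂ _+_ (cong (𝟙 ∘ (D ∣ᵇ_)) (sym (ℤP.+-identityˡ c)))
             (sumRange-cong D (λ i → cong (𝟙 ∘ (D ∣ᵇ_)) (solve 2 (λ a c →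
               a :+ (c :+ con (+ 1)) :=
               (con (+ 1) :+ a) :+ c) refl (+ i) c))) ⟩
      sumRange (suc D) h
        ≡⟨ sumRange-suc D h ⟩
      window c + 𝟙 (D ∣ᵇ (+ D ℤ.+ c))
        ≡⟨ cong (λ b → window c + 𝟙 b)
             (∣ᵇ-cong (λ D∣ → ℤ∣.∣m+n∣m⇒∣n D∣ ℤ∣.∣-refl) (ℤ∣.∣m∣n⇒∣m+n ℤ∣.∣-refl)) ⟩
      window c + 𝟙 (D ∣ᵇ c)
        ≡⟨ ℕP.+-comm (window c) _ ⟩
      𝟙 (D ∣ᵇ c) + window c ∎)
      where
      open ≡-Reasoning
      open ℤ-Solver
      h : ℕ → ℕ
      h x = 𝟙 (D ∣ᵇ (+ x ℤ.+ c))

    window-0 : window (+ 0) ≡ 1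
    window-0 = cong₂ _+_ (cong 𝟙 (∣ᵇ-complete {D} {+ 0 ℤ.+ + 0} (divides (+ 0) refl)))
      (sumRange-zero D-1 _ (λ i i<D-1 → cong 𝟙 (∣ᵇ-false (small i i<D-1))))
      where
      small : ∀ i → i < D-1 → ¬ + D ℤ∣.∣ (+ suc i ℤ.+ + 0)
      small i i<D-1 D∣ = ℕP.<-irrefl refl (ℕP.<-≤-trans (s≤s i<D-1)
        (subst (D ≤_) (ℕP.+-identityʳ (suc i)) (ℕ∣.∣⇒≤ (ℤ∣.∣⇒∣ᵤ D∣))))

    window≡1 : ∀ c → window c ≡ 1
    window≡1 (+ zero)        = window-0
    window≡1 (+ suc n)       = trans (cong (window ∘ +_) (ℕP.+-comm 1 n))
                                 (trans (window-suc (+ n)) (window≡1 (+ n)))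
    window≡1 -[1+ zero ]     = trans (sym (window-suc -[1+ zero ])) window-0
    window≡1 -[1+ suc n ]    = trans (sym (window-suc -[1+ suc n ])) (window≡1 -[1+ n ])

  count-multiples : ∀ M c → sumRange (D * M) (λ x → 𝟙 (D ∣ᵇ (+ x ℤ.+ c))) ≡ M
  count-multiples zero    c = sumRange-zero (D * 0) _
    (λ i i<0 → ⊥-elim (ℕP.n≮0 (subst (i <_) (ℕP.*-zeroʳ D) i<0)))
  count-multiples (suc M) c = begin
    sumRange (D * suc M) h
      ≡⟨ cong (λ k → sumRange k h) (ℕP.*-suc D M) ⟩
    sumRange (D + D * M) h
      ≡⟨ sumRange-+ D (D * M) h ⟩
    window c + sumRange (D * M) (λ i → h (D + i))
      ≡⟨ cong₂ _+_ (window≡1 c) (sumRange-cong (D * M) (λ i → cong (𝟙 ∘ (D ∣ᵇ_))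
           (solve 2 (λ a c → (con (+ D) :+ a) :+ c :=
             a :+ (con (+ D) :+ c)) refl (+ i) c))) ⟩
    1 + sumRange (D * M) (λ x → 𝟙 (D ∣ᵇ (+ x ℤ.+ (+ D ℤ.+ c))))
      ≡⟨ cong suc (count-multiples M (+ D ℤ.+ c)) ⟩
    suc M ∎
    where
    open ≡-Reasoning
    open ℤ-Solver
    h : ℕ → ℕ
    h x = 𝟙 (D ∣ᵇ (+ x ℤ.+ c))

coprime-prime : ∀ {p m} → Prime p → ¬ p ℕ∣.∣ m → Coprime p m
coprime-prime prime-p p∤m (d∣p , d∣m) with prime⇒irreducible prime-p d∣p
... | inj₁ d≡1 = d≡1
... | inj₂ refl = ⊥-elim (p∤m d∣m)

coprime-prime^ : ∀ {p m} → Prime p → ¬ p ℕ∣.∣ m → ∀ k → Coprime (p ^ k) m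
coprime-prime^ {m = m} prime-p p∤m zero = Coprime.1-coprimeTo m
coprime-prime^ {p} prime-p p∤m (suc k) {d} (d∣p^k⁺¹ , d∣m) =
  coprime-prime^ prime-p p∤m k (Coprime.coprime-divisor d⊥p d∣p^k⁺¹ , d∣m)
  where
  d⊥p : Coprime d p
  d⊥p (e∣d , e∣p) = coprime-prime prime-p p∤m (e∣p , ℕ∣.∣-trans e∣d d∣m)

prime∤1 : ∀ {p} → Prime p → ¬ + p ℤ∣.∣ + 1
prime∤1 prime-p p∣1 with ℕ∣.∣1⇒≡1 (ℤ∣.∣⇒∣ᵤ p∣1)
... | refl = ¬prime[1] prime-p

module _ where
  open ℤ-Solver

  private
    pos-affine : ∀ a b c d → 1 + a * b ≡ c * d → + 1 ℤ.+ + a ℤ.* + b ≡ + c ℤ.* + d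
    pos-affine a b c d eq =
      trans (cong (λ z → + 1 ℤ.+ z) (sym (ℤP.pos-* a b))) (trans (cong +_ eq) (ℤP.pos-* c d))

  inverse-ℕ : ∀ {P m} → Coprime m P → ∃ λ u → + P ℤ∣.∣ (u ℤ.* + m ℤ.- + 1)
  inverse-ℕ {P} {m} m⊥P with Coprime.coprime-Bézout m⊥P
  ... | Bézout.+- x y eq = + x , divides (+ y) (begin
    + x ℤ.* + m ℤ.- + 1             ≡⟨ cong (ℤ._- + 1) (sym (pos-affine y P x m eq)) ⟩
    + 1 ℤ.+ + y ℤ.* + P ℤ.- + 1     ≡⟨ solve 1 (λ w → con (+ 1) :+ w :- con (+ 1) := w) refl (+ y ℤ.* + P) ⟩
    + y ℤ.* + P                     ∎)
    where open ≡-Reasoning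
  ... | Bézout.-+ x y eq = ℤ.- + x , divides (ℤ.- + y) (begin
    ℤ.- + x ℤ.* + m ℤ.- + 1         ≡⟨ solve 2 (λ a b → :- a :* b :- con (+ 1) := :- (con (+ 1) :+ a :* b))
                                         refl (+ x) (+ m) ⟩
    ℤ.- (+ 1 ℤ.+ + x ℤ.* + m)       ≡⟨ cong ℤ.-_ (pos-affine x m y P eq) ⟩
    ℤ.- (+ y ℤ.* + P)               ≡⟨ solve 2 (λ a b → :- (a :* b) := :- a :* b) refl (+ y) (+ P) ⟩
    ℤ.- + y ℤ.* + P                 ∎)
    where open ≡-Reasoning

  inverse-mod-prime^ : ∀ {p} → Prime p → ∀ {Z} → ¬ + p ℤ∣.∣ Z → ∀ k →
    ∃ λ u → + (p ^ k) ℤ∣.∣ (u ℤ.* Z ℤ.- + 1)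
  inverse-mod-prime^ {p} prime-p {+ m} p∤Z k =
    inverse-ℕ (Coprime.sym (coprime-prime^ prime-p (p∤Z ∘ ℤ∣.∣ᵤ⇒∣) k))
  inverse-mod-prime^ {p} prime-p { -[1+ n ] } p∤Z k
    with inverse-ℕ (Coprime.sym (coprime-prime^ prime-p (p∤Z ∘ ℤ∣.∣ᵤ⇒∣) k))
  ... | u , P∣ = ℤ.- u , subst (λ z → + (p ^ k) ℤ∣.∣ (z ℤ.- + 1))
                   (solve 2 (λ u x → u :* x := (:- u) :* (:- x)) refl u (+ suc n)) P∣

module _ {p} (prime-p : Prime p) where
  private instance _ = prime⇒nonZero prime-p

  p^-∣-p^ : ∀ {a b} → a ≤ b → + (p ^ a) ℤ∣.∣ + (p ^ b)
  p^-∣-p^ {a} {b} a≤b = ℤ∣.∣ᵤ⇒∣ (ℕ∣.divides (p ^ (b ∸ a))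
    (trans (cong (p ^_) (sym (ℕP.m∸n+n≡m a≤b))) (ℕP.^-distribˡ-+-* p (b ∸ a) a)))

  -- After cancelling p^d, the congruence reads y ≡ -u c″ (mod p^(k-d)) with u Z″ ≡ 1.
  linear-congruence-count : ∀ ν k d → d ≤ k → k ≤ ν → ∀ {Z″ c″} → ¬ + p ℤ∣.∣ Z″ →
    ∀ {Z c} → Z ≡ + (p ^ d) ℤ.* Z″ → c ≡ + (p ^ d) ℤ.* c″ →
    sumRange (p ^ ν) (λ y → 𝟙 (p ^ k ∣ᵇ (+ y ℤ.* Z ℤ.+ c))) ≡ p ^ (ν ∸ k + d)
  linear-congruence-count ν k d d≤k k≤ν {Z″} {c″} p∤Z″ {Z} {c} refl refl = begin
    sumRange (p ^ ν) (λ y → 𝟙 (p ^ k ∣ᵇ (+ y ℤ.* Z ℤ.+ c)))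
      ≡⟨ cong (λ n → sumRange n _) p^ν≡D*M ⟩
    sumRange (D * p ^ M) (λ y → 𝟙 (p ^ k ∣ᵇ (+ y ℤ.* Z ℤ.+ c)))
      ≡⟨ sumRange-cong (D * p ^ M) (λ y → cong 𝟙 (∣ᵇ-cong (to y) (from y))) ⟩
    sumRange (D * p ^ M) (λ y → 𝟙 (D ∣ᵇ (+ y ℤ.+ u ℤ.* c″)))
      ≡⟨ count-multiples (pred D) (p ^ M) (u ℤ.* c″) ⟩
    p ^ M ∎
    where
    open ≡-Reasoning
    instance
      _ = ℕP.m^n≢0 p (k ∸ d)
      _ = ℕP.m^n≢0 p d
    M = ν ∸ k + d
    D = suc (pred (p ^ (k ∸ d)))
    D≡ : D ≡ p ^ (k ∸ d)
    D≡ = ℕP.suc-pred (p ^ (k ∸ d))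
    inv = inverse-mod-prime^ prime-p p∤Z″ (k ∸ d)
    u = proj₁ inv
    D∣uZ″-1 : + D ℤ∣.∣ (u ℤ.* Z″ ℤ.- + 1)
    D∣uZ″-1 = subst (λ n → + n ℤ∣.∣ (u ℤ.* Z″ ℤ.- + 1)) (sym D≡) (proj₂ inv)
    p^ν≡D*M : p ^ ν ≡ D * p ^ M
    p^ν≡D*M = begin
      p ^ ν                    ≡⟨ cong (p ^_) (sym (+-exponents)) ⟩
      p ^ ((k ∸ d) + M)        ≡⟨ ℕP.^-distribˡ-+-* p (k ∸ d) M ⟩
      p ^ (k ∸ d) * p ^ M      ≡⟨ cong (_* p ^ M) (sym D≡) ⟩
      D * p ^ M                ∎
      where
      +-exponents : (k ∸ d) + (ν ∸ k + d) ≡ ν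
      +-exponents = begin
        (k ∸ d) + (ν ∸ k + d)  ≡⟨ cong (λ z → (k ∸ d) + z) (ℕP.+-comm (ν ∸ k) d) ⟩
        (k ∸ d) + (d + (ν ∸ k))  ≡⟨ sym (ℕP.+-assoc (k ∸ d) d (ν ∸ k)) ⟩
        (k ∸ d) + d + (ν ∸ k)    ≡⟨ cong (_+ (ν ∸ k)) (ℕP.m∸n+n≡m d≤k) ⟩
        k + (ν ∸ k)              ≡⟨ ℕP.m+[n∸m]≡n k≤ν ⟩
        ν                        ∎
    p^k≡p^d*D : + (p ^ k) ≡ + (p ^ d) ℤ.* + D
    p^k≡p^d*D = trans (cong (λ n → + (p ^ n)) (sym (ℕP.m+[n∸m]≡n d≤k)))
      (trans (cong +_ (ℕP.^-distribˡ-+-* p d (k ∸ d)))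
        (trans (ℤP.pos-* (p ^ d) _) (cong (λ n → + (p ^ d) ℤ.* + n) (sym D≡))))
    module _ (y : ℕ) where
      L = + y ℤ.* Z″ ℤ.+ c″
      yZ+c≡p^dL : + y ℤ.* (+ (p ^ d) ℤ.* Z″) ℤ.+ + (p ^ d) ℤ.* c″ ≡ + (p ^ d) ℤ.* L
      yZ+c≡p^dL = solve 4 (λ y P z c → y :* (P :* z) :+ P :* c := P :* (y :* z :+ c))
        refl (+ y) (+ (p ^ d)) Z″ c″
        where open ℤ-Solver
      to : + (p ^ k) ℤ∣.∣ (+ y ℤ.* Z ℤ.+ c) → + D ℤ∣.∣ (+ y ℤ.+ u ℤ.* c″)
      to p^k∣ = subst (+ D ℤ∣.∣_)
        (solve 4 (λ u y z c → u :* (y :* z :+ c) :- y :* (u :* z :- con (+ 1)) := y :+ u :* c)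
          refl u (+ y) Z″ c″)
        (ℤ∣.∣m∣n⇒∣m-n (ℤ∣.∣n⇒∣m*n u D∣L) (ℤ∣.∣n⇒∣m*n (+ y) D∣uZ″-1))
        where
        open ℤ-Solver
        D∣L : + D ℤ∣.∣ L
        D∣L = ℤ∣.*-cancelˡ-∣ (+ (p ^ d)) (subst₂ ℤ∣._∣_ p^k≡p^d*D yZ+c≡p^dL p^k∣)
      from : + D ℤ∣.∣ (+ y ℤ.+ u ℤ.* c″) → + (p ^ k) ℤ∣.∣ (+ y ℤ.* Z ℤ.+ c)
      from D∣ = subst₂ ℤ∣._∣_ (sym p^k≡p^d*D) (sym yZ+c≡p^dL) (ℤ∣.*-monoʳ-∣ (+ (p ^ d)) D∣L)
        where
        open ℤ-Solver
        D∣L : + D ℤ∣.∣ L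
        D∣L = subst (+ D ℤ∣.∣_)
          (solve 4 (λ u y z c → z :* (y :+ u :* c) :- c :* (u :* z :- con (+ 1)) := y :* z :+ c)
            refl u (+ y) Z″ c″)
          (ℤ∣.∣m∣n⇒∣m-n (ℤ∣.∣n⇒∣m*n Z″ D∣) (ℤ∣.∣n⇒∣m*n c″ D∣uZ″-1))

module _ (p : ℕ) .{{_ : NonZero p}} where
  open +-*-Solver

  exponent-bound-low : ∀ ν e d → d ≤ e →
    p ^ (ν + e) * (p ∸ 1) ≤ p ^ suc (e ∸ d) * (p ^ ν * p ^ d)
  exponent-bound-low ν e d d≤e = begin
    p ^ (ν + e) * (p ∸ 1)                 ≤⟨ ℕP.*-monoʳ-≤ (p ^ (ν + e)) (ℕP.m∸n≤m p 1) ⟩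
    p ^ (ν + e) * p                       ≡⟨ cong (λ k → p ^ (ν + k) * p) (sym (ℕP.m∸n+n≡m d≤e)) ⟩
    p ^ (ν + (e ∸ d + d)) * p             ≡⟨ cong (_* p) (trans (ℕP.^-distribˡ-+-* p ν (e ∸ d + d))
                                               (cong (p ^ ν *_) (ℕP.^-distribˡ-+-* p (e ∸ d) d))) ⟩
    p ^ ν * (p ^ (e ∸ d) * p ^ d) * p     ≡⟨ solve 4 (λ a b c p → a :* (b :* c) :* p := p :* b :* (a :* c))
                                               refl (p ^ ν) (p ^ (e ∸ d)) (p ^ d) p ⟩
    p * p ^ (e ∸ d) * (p ^ ν * p ^ d)     ∎
    where open ℕP.≤-Reasoning

  exponent-bound-N : ∀ ν e G → e < ν → G + p ^ (ν ∸ 1) ≡ p ^ ν →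
    p ^ (ν + e) * (p ∸ 1) ≤ p ^ suc (e ∸ e) * (p ^ e * G)
  exponent-bound-N (suc ν) e G _ G+p^ν≡ = ℕP.≤-reflexive (begin
    p ^ (suc ν + e) * (p ∸ 1)         ≡⟨ cong (_* (p ∸ 1)) (trans (cong (p ^_) (ℕP.+-comm (suc ν) e))
                                           (ℕP.^-distribˡ-+-* p e (suc ν))) ⟩
    p ^ e * p ^ suc ν * (p ∸ 1)       ≡⟨ ℕP.*-assoc (p ^ e) (p ^ suc ν) (p ∸ 1) ⟩
    p ^ e * (p ^ suc ν * (p ∸ 1))     ≡⟨ cong (p ^ e *_) p^ν⁺¹[p-1]≡pG ⟩
    p ^ e * (p * G)                   ≡⟨ solve 3 (λ a p g → a :* (p :* g) := p :* con 1 :* (a :* g))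
                                           refl (p ^ e) p G ⟩
    p * 1 * (p ^ e * G)               ≡⟨ cong (λ k → p * p ^ k * (p ^ e * G)) (sym (ℕP.n∸n≡0 e)) ⟩
    p * p ^ (e ∸ e) * (p ^ e * G)     ∎)
    where
    open ≡-Reasoning
    p^ν⁺¹[p-1]≡pG : p ^ suc ν * (p ∸ 1) ≡ p * G
    p^ν⁺¹[p-1]≡pG = begin
      p ^ suc ν * (p ∸ 1)               ≡⟨ ℕP.*-distribˡ-∸ (p ^ suc ν) p 1 ⟩
      p ^ suc ν * p ∸ p ^ suc ν * 1     ≡⟨ cong₂ _∸_ (trans (ℕP.*-comm (p ^ suc ν) p) (cong (p *_) (sym G+p^ν≡)))
                                             (ℕP.*-identityʳ (p ^ suc ν)) ⟩
      p * (G + p ^ ν) ∸ p ^ suc ν       ≡⟨ cong (_∸ p ^ suc ν) (ℕP.*-distribˡ-+ p G (p ^ ν)) ⟩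
      p * G + p ^ suc ν ∸ p ^ suc ν     ≡⟨ ℕP.m+n∸n≡m (p * G) (p ^ suc ν) ⟩
      p * G                             ∎

module TwoVariable {p} (prime-p : Prime p) (ν : ℕ) (N : ℤ) where
  open ℤ-Solver
  private instance _ = prime⇒nonZero prime-p

  q : ℕ
  q = p ^ ν

  form : (B₁ B₂ : ℤ) (x₀ y₀ : ℕ) (c : ℤ) (x y : ℕ) → ℤ
  form B₁ B₂ x₀ y₀ c x y =
    c ℤ.+ (+ x ℤ.- + x₀) ℤ.* B₁ ℤ.+ (+ y ℤ.- + y₀) ℤ.* B₂ ℤ.+ N ℤ.* (+ x ℤ.- + x₀) ℤ.* (+ y ℤ.- + y₀)

  column : (B₁ B₂ : ℤ) (x₀ y₀ : ℕ) (c : ℤ) (x : ℕ) → ℕ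
  column B₁ B₂ x₀ y₀ c x = sumRange q (λ y → 𝟙 (q ∣ᵇ form B₁ B₂ x₀ y₀ c x y))

  count : (B₁ B₂ : ℤ) (x₀ y₀ : ℕ) (c : ℤ) → ℕ
  count B₁ B₂ x₀ y₀ c = sumRange q (column B₁ B₂ x₀ y₀ c)

  count-swap : ∀ B₁ B₂ x₀ y₀ c → count B₁ B₂ x₀ y₀ c ≡ count B₂ B₁ y₀ x₀ c
  count-swap B₁ B₂ x₀ y₀ c = trans (sumRange-comm q q _)
    (sumRange-cong q (λ y → sumRange-cong q (λ x → cong (𝟙 ∘ (q ∣ᵇ_))
      (solve 8 (λ c x x₀ y y₀ B₁ B₂ n →
        c :+ (x :- x₀) :* B₁ :+ (y :- y₀) :* B₂ :+ n :* (x :- x₀) :* (y :- y₀) :=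
        c :+ (y :- y₀) :* B₂ :+ (x :- x₀) :* B₁ :+ n :* (y :- y₀) :* (x :- x₀))
        refl c (+ x) (+ x₀) (+ y) (+ y₀) B₁ B₂ N))))

  private
    p^suc : ∀ d → + (p ^ suc d) ≡ + p ℤ.* + (p ^ d)
    p^suc d = ℤP.pos-* p (p ^ d)

    quotient-eq : ∀ {a z} (a∣z : + a ℤ∣.∣ z) → z ≡ + a ℤ.* ℤ∣.quotient a∣z
    quotient-eq (divides k eq) = trans eq (ℤP.*-comm k _)

  -- For fixed x the form is linear in y with coefficient B₂ + N s.
  column-count : ∀ B₁ B₂ x₀ y₀ c x d → d ≤ ν → ∀ {Z″} → ¬ + p ℤ∣.∣ Z″ →
    B₂ ℤ.+ N ℤ.* (+ x ℤ.- + x₀) ≡ + (p ^ d) ℤ.* Z″ →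
    + (p ^ d) ℤ∣.∣ (c ℤ.+ (+ x ℤ.- + x₀) ℤ.* B₁) →
    column B₁ B₂ x₀ y₀ c x ≡ p ^ d
  column-count B₁ B₂ x₀ y₀ c x d d≤ν {Z″} p∤Z″ coeff≡ p^d∣ = begin
    column B₁ B₂ x₀ y₀ c x
      ≡⟨ sumRange-cong q (λ y → cong (𝟙 ∘ (q ∣ᵇ_)) (linear y)) ⟩
    sumRange q (λ y → 𝟙 (q ∣ᵇ (+ y ℤ.* Z ℤ.+ c′)))
      ≡⟨ linear-congruence-count prime-p ν ν d d≤ν ℕP.≤-refl p∤Z″ coeff≡ c′≡ ⟩
    p ^ (ν ∸ ν + d)
      ≡⟨ cong (λ k → p ^ (k + d)) (ℕP.n∸n≡0 ν) ⟩
    p ^ d ∎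
    where
    open ≡-Reasoning
    s = + x ℤ.- + x₀
    Z = B₂ ℤ.+ N ℤ.* s
    c₁ = ℤ∣.quotient p^d∣
    c′ = c ℤ.+ s ℤ.* B₁ ℤ.- + y₀ ℤ.* Z
    linear : ∀ y → form B₁ B₂ x₀ y₀ c x y ≡ + y ℤ.* Z ℤ.+ c′
    linear y = solve 7 (λ c s B₁ y y₀ B₂ n →
      c :+ s :* B₁ :+ (y :- y₀) :* B₂ :+ n :* s :* (y :- y₀) :=
      y :* (B₂ :+ n :* s) :+ (c :+ s :* B₁ :- y₀ :* (B₂ :+ n :* s)))
      refl c s B₁ (+ y) (+ y₀) B₂ N
    c′≡ : c′ ≡ + (p ^ d) ℤ.* (c₁ ℤ.- + y₀ ℤ.* Z″)
    c′≡ = trans (cong₂ (λ a b → a ℤ.- + y₀ ℤ.* b) (quotient-eq p^d∣) coeff≡)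
      (solve 4 (λ P c y z → P :* c :- y :* (P :* z) := P :* (c :- y :* z)) refl (+ (p ^ d)) c₁ (+ y₀) Z″)

  -- Every column contributes p^d solutions, since p ∤ B″ + p N₁ s.
  count-low-valuation : ∀ B₁ B₂ x₀ y₀ d → d ≤ ν → ∀ {B″ N₁} → ¬ + p ℤ∣.∣ B″ →
    B₂ ≡ + (p ^ d) ℤ.* B″ → N ≡ + (p ^ suc d) ℤ.* N₁ → + (p ^ d) ℤ∣.∣ B₁ →
    ∀ c → + (p ^ d) ℤ∣.∣ c → count B₁ B₂ x₀ y₀ c ≡ q * p ^ d
  count-low-valuation B₁ B₂ x₀ y₀ d d≤ν {B″} {N₁} p∤B″ B₂≡ N≡ p^d∣B₁ c p^d∣c =
    trans (sumRange-cong q (λ x → column-count B₁ B₂ x₀ y₀ c x d d≤ν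
            (p∤Z″ x) (coeff≡ x) (ℤ∣.∣m∣n⇒∣m+n p^d∣c (ℤ∣.∣n⇒∣m*n (+ x ℤ.- + x₀) p^d∣B₁))))
          (sumRange-const q (p ^ d))
    where
    Z″ : ℕ → ℤ
    Z″ x = B″ ℤ.+ + p ℤ.* (N₁ ℤ.* (+ x ℤ.- + x₀))
    p∤Z″ : ∀ x → ¬ + p ℤ∣.∣ Z″ x
    p∤Z″ x p∣ = p∤B″ (ℤ∣.∣m+n∣n⇒∣m p∣ (ℤ∣.∣m⇒∣m*n _ ℤ∣.∣-refl))
    coeff≡ : ∀ x → B₂ ℤ.+ N ℤ.* (+ x ℤ.- + x₀) ≡ + (p ^ d) ℤ.* Z″ x
    coeff≡ x = trans (cong₂ (λ a b → a ℤ.+ b ℤ.* (+ x ℤ.- + x₀)) B₂≡ (trans N≡ (cong (ℤ._* N₁) (p^suc d))))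
      (solve 5 (λ P B p n s → P :* B :+ p :* P :* n :* s := P :* (B :+ p :* (n :* s)))
        refl (+ (p ^ d)) B″ (+ p) N₁ (+ x ℤ.- + x₀))

  private
    𝟙-not : ∀ b → 𝟙 (not b) + 𝟙 b ≡ 1
    𝟙-not true  = refl
    𝟙-not false = refl

  -- The column at x has p^e solutions unless p ∣ B₂/p^e + N′ s,
  -- which happens for exactly p^(ν-1) values of x.
  count-valuation-N : ∀ B₁ B₂ x₀ y₀ e → e < ν → ∀ {N′} → ¬ + p ℤ∣.∣ N′ → N ≡ + (p ^ e) ℤ.* N′ →
    + (p ^ e) ℤ∣.∣ B₁ → + (p ^ e) ℤ∣.∣ B₂ →
    ∃ λ G → G + p ^ (ν ∸ 1) ≡ q × (∀ c → + (p ^ e) ℤ∣.∣ c → p ^ e * G ≤ count B₁ B₂ x₀ y₀ c)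
  count-valuation-N B₁ B₂ x₀ y₀ e e<ν {N′} p∤N′ N≡ p^e∣B₁ p^e∣B₂ = G , G+bad≡q , bound
    where
    b₂ = ℤ∣.quotient p^e∣B₂
    Z″ : ℕ → ℤ
    Z″ x = b₂ ℤ.+ N′ ℤ.* (+ x ℤ.- + x₀)
    G = sumRange q (λ x → 𝟙 (not (p ^ 1 ∣ᵇ Z″ x)))
    bad≡ : sumRange q (λ x → 𝟙 (p ^ 1 ∣ᵇ Z″ x)) ≡ p ^ (ν ∸ 1)
    bad≡ = begin
      sumRange q (λ x → 𝟙 (p ^ 1 ∣ᵇ Z″ x))
        ≡⟨ sumRange-cong q (λ x → cong (𝟙 ∘ (p ^ 1 ∣ᵇ_)) (solve 4 (λ b n x x₀ →
             b :+ n :* (x :- x₀) := x :* n :+ (b :- n :* x₀)) refl b₂ N′ (+ x) (+ x₀))) ⟩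
      sumRange q (λ x → 𝟙 (p ^ 1 ∣ᵇ (+ x ℤ.* N′ ℤ.+ (b₂ ℤ.- N′ ℤ.* + x₀))))
        ≡⟨ linear-congruence-count prime-p ν 1 0 z≤n (ℕP.≤-trans (s≤s z≤n) e<ν) p∤N′ (sym (ℤP.*-identityˡ N′))
             (sym (ℤP.*-identityˡ _)) ⟩
      p ^ (ν ∸ 1 + 0)
        ≡⟨ cong (p ^_) (ℕP.+-identityʳ (ν ∸ 1)) ⟩
      p ^ (ν ∸ 1) ∎
      where open ≡-Reasoning
    G+bad≡q : G + p ^ (ν ∸ 1) ≡ q
    G+bad≡q = begin
      G + p ^ (ν ∸ 1)
        ≡⟨ cong (λ b → G + b) (sym bad≡) ⟩
      G + sumRange q (λ x → 𝟙 (p ^ 1 ∣ᵇ Z″ x))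
        ≡⟨ sym (sumRange-distrib-+ q _ _) ⟩
      sumRange q (λ x → 𝟙 (not (p ^ 1 ∣ᵇ Z″ x)) + 𝟙 (p ^ 1 ∣ᵇ Z″ x))
        ≡⟨ trans (sumRange-cong q (𝟙-not ∘ (p ^ 1 ∣ᵇ_) ∘ Z″)) (sumRange-const q 1) ⟩
      q * 1
        ≡⟨ ℕP.*-identityʳ q ⟩
      q ∎
      where open ≡-Reasoning
    coeff≡ : ∀ x → B₂ ℤ.+ N ℤ.* (+ x ℤ.- + x₀) ≡ + (p ^ e) ℤ.* Z″ x
    coeff≡ x = trans (cong₂ (λ a b → a ℤ.+ b ℤ.* (+ x ℤ.- + x₀)) (quotient-eq p^e∣B₂) N≡)
      (solve 4 (λ P b n s → P :* b :+ P :* n :* s := P :* (b :+ n :* s))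
        refl (+ (p ^ e)) b₂ N′ (+ x ℤ.- + x₀))
    bound : ∀ c → + (p ^ e) ℤ∣.∣ c → p ^ e * G ≤ count B₁ B₂ x₀ y₀ c
    bound c p^e∣c = subst (_≤ count B₁ B₂ x₀ y₀ c) (sumRange-*ˡ q (p ^ e) _) (sumRange-mono q column-≥)
      where
      column-≥ : ∀ x → p ^ e * 𝟙 (not (p ^ 1 ∣ᵇ Z″ x)) ≤ column B₁ B₂ x₀ y₀ c x
      column-≥ x with + (p ^ 1) ℤ∣.∣? Z″ x
      ... | yes _ = subst (_≤ column B₁ B₂ x₀ y₀ c x) (sym (ℕP.*-zeroʳ (p ^ e))) z≤n
      ... | no p∤ = subst (_≤ column B₁ B₂ x₀ y₀ c x) (sym (ℕP.*-identityʳ (p ^ e)))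
        (ℕP.≤-reflexive (sym (column-count B₁ B₂ x₀ y₀ c x e (ℕP.<⇒≤ e<ν)
          (p∤ ∘ subst (λ n → + n ℤ∣.∣ Z″ x) (sym (ℕP.*-identityʳ p))) (coeff≡ x)
          (ℤ∣.∣m∣n⇒∣m+n p^e∣c (ℤ∣.∣n⇒∣m*n (+ x ℤ.- + x₀) p^e∣B₁)))))

  count-all-divisible : ∀ B₁ B₂ x₀ y₀ → + q ℤ∣.∣ B₁ → + q ℤ∣.∣ B₂ → + q ℤ∣.∣ N →
    ∀ c → + q ℤ∣.∣ c → count B₁ B₂ x₀ y₀ c ≡ q * q
  count-all-divisible B₁ B₂ x₀ y₀ q∣B₁ q∣B₂ q∣N c q∣c =
    trans (sumRange-cong q (λ x → trans (sumRange-cong q (λ y → cong 𝟙 (∣ᵇ-complete (q∣form x y))))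
                                        (trans (sumRange-const q 1) (ℕP.*-identityʳ q))))
          (sumRange-const q q)
    where
    q∣form : ∀ x y → + q ℤ∣.∣ form B₁ B₂ x₀ y₀ c x y
    q∣form x y = ℤ∣.∣m∣n⇒∣m+n
      (ℤ∣.∣m∣n⇒∣m+n (ℤ∣.∣m∣n⇒∣m+n q∣c (ℤ∣.∣n⇒∣m*n (+ x ℤ.- + x₀) q∣B₁)) (ℤ∣.∣n⇒∣m*n (+ y ℤ.- + y₀) q∣B₂))
      (ℤ∣.∣m⇒∣m*n (+ y ℤ.- + y₀) (ℤ∣.∣m⇒∣m*n (+ x ℤ.- + x₀) q∣N))

  common-valuation : ∀ B₁ B₂ e → (+ (p ^ e) ℤ∣.∣ B₁ × + (p ^ e) ℤ∣.∣ B₂) ⊎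
    ∃ λ d → d < e × + (p ^ d) ℤ∣.∣ B₁ × + (p ^ d) ℤ∣.∣ B₂ ×
            (¬ + (p ^ suc d) ℤ∣.∣ B₁ ⊎ ¬ + (p ^ suc d) ℤ∣.∣ B₂)
  common-valuation B₁ B₂ zero = inj₁ (ℤ∣.∣ᵤ⇒∣ (ℕ∣.1∣ _) , ℤ∣.∣ᵤ⇒∣ (ℕ∣.1∣ _))
  common-valuation B₁ B₂ (suc e) with common-valuation B₁ B₂ e
  ... | inj₂ (d , d<e , rest) = inj₂ (d , ℕP.m≤n⇒m≤1+n d<e , rest)
  ... | inj₁ (h₁ , h₂) with + (p ^ suc e) ℤ∣.∣? B₁ | + (p ^ suc e) ℤ∣.∣? B₂
  ...   | yes h₁′ | yes h₂′ = inj₁ (h₁′ , h₂′)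
  ...   | no ¬h₁′ | _       = inj₂ (e , ℕP.≤-refl , h₁ , h₂ , inj₁ ¬h₁′)
  ...   | yes _   | no ¬h₂′ = inj₂ (e , ℕP.≤-refl , h₁ , h₂ , inj₂ ¬h₂′)

  exact-factor : ∀ d {X} → + (p ^ d) ℤ∣.∣ X → ¬ + (p ^ suc d) ℤ∣.∣ X →
    ∃ λ X′ → X ≡ + (p ^ d) ℤ.* X′ × ¬ + p ℤ∣.∣ X′
  exact-factor d p^d∣X ¬p^d⁺¹∣X = ℤ∣.quotient p^d∣X , quotient-eq p^d∣X ,
    λ { (divides k eq) → ¬p^d⁺¹∣X (divides k (trans (quotient-eq p^d∣X)
      (trans (cong (+ (p ^ d) ℤ.*_) eq)
        (trans (solve 3 (λ P k p → P :* (k :* p) := k :* (p :* P)) refl (+ (p ^ d)) k (+ p))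
          (cong (k ℤ.*_) (sym (p^suc d))))))) }

  two-variable-bound : ∀ B₁ B₂ x₀ y₀ e → e ≤ ν → + (p ^ e) ℤ∣.∣ N →
    (e < ν → ¬ + (p ^ suc e) ℤ∣.∣ N) →
    ∃ λ ℓ → ℓ ≤ e × ∃ λ K → p ^ (ν + e) * (p ∸ 1) ≤ p ^ suc (e ∸ ℓ) * K ×
      (∀ c → + (p ^ ℓ) ℤ∣.∣ c → K ≤ count B₁ B₂ x₀ y₀ c)
  two-variable-bound B₁ B₂ x₀ y₀ e e≤ν p^e∣N p^e⁺¹∤N with common-valuation B₁ B₂ e
  ... | inj₂ (d , d<e , p^d∣B₁ , p^d∣B₂ , inj₂ p^d⁺¹∤B₂) =
    d , ℕP.<⇒≤ d<e , q * p ^ d , exponent-bound-low p ν e d (ℕP.<⇒≤ d<e) ,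
    λ c p^d∣c → ℕP.≤-reflexive (sym (count-low-valuation B₁ B₂ x₀ y₀ d d≤ν
      (proj₂ (proj₂ B₂′)) (proj₁ (proj₂ B₂′)) (quotient-eq p^d⁺¹∣N) p^d∣B₁ c p^d∣c))
    where
    d≤ν = ℕP.≤-trans (ℕP.<⇒≤ d<e) e≤ν
    B₂′ = exact-factor d p^d∣B₂ p^d⁺¹∤B₂
    p^d⁺¹∣N = ℤ∣.∣-trans (p^-∣-p^ prime-p d<e) p^e∣N
  ... | inj₂ (d , d<e , p^d∣B₁ , p^d∣B₂ , inj₁ p^d⁺¹∤B₁) =
    d , ℕP.<⇒≤ d<e , q * p ^ d , exponent-bound-low p ν e d (ℕP.<⇒≤ d<e) ,
    λ c p^d∣c → ℕP.≤-reflexive (sym (trans (count-swap B₁ B₂ x₀ y₀ c)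
      (count-low-valuation B₂ B₁ y₀ x₀ d d≤ν
        (proj₂ (proj₂ B₁′)) (proj₁ (proj₂ B₁′)) (quotient-eq p^d⁺¹∣N) p^d∣B₂ c p^d∣c)))
    where
    d≤ν = ℕP.≤-trans (ℕP.<⇒≤ d<e) e≤ν
    B₁′ = exact-factor d p^d∣B₁ p^d⁺¹∤B₁
    p^d⁺¹∣N = ℤ∣.∣-trans (p^-∣-p^ prime-p d<e) p^e∣N
  ... | inj₁ (p^e∣B₁ , p^e∣B₂) with e ℕP.<? ν
  ...   | yes e<ν = e , ℕP.≤-refl , p ^ e * G , exponent-bound-N p ν e G e<ν G+p^ν⁻¹≡q , bound
    where
    N′ = exact-factor e p^e∣N (p^e⁺¹∤N e<ν)
    split = count-valuation-N B₁ B₂ x₀ y₀ e e<ν (proj₂ (proj₂ N′)) (proj₁ (proj₂ N′)) p^e∣B₁ p^e∣B₂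
    G = proj₁ split
    G+p^ν⁻¹≡q = proj₁ (proj₂ split)
    bound = proj₂ (proj₂ split)
  ...   | no e≮ν rewrite ℕP.≤-antisym e≤ν (ℕP.≮⇒≥ e≮ν) =
    ν , ℕP.≤-refl , q * q , exponent-bound-low p ν ν ν ℕP.≤-refl ,
    λ c q∣c → ℕP.≤-reflexive (sym (count-all-divisible B₁ B₂ x₀ y₀ p^e∣B₁ p^e∣B₂ p^e∣N c q∣c))

+-move-last : ∀ a b c d e f n → a ℚ.+ b ℚ.+ c ℚ.+ d ℚ.+ e ℚ.+ f ℚ.+ n ≡ a ℚ.+ n ℚ.+ b ℚ.+ c ℚ.+ d ℚ.+ e ℚ.+ f
+-move-last = ℚ-Solver.solve 7 (λ a b c d e f n → let open ℚ-Solver in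
  a :+ b :+ c :+ d :+ e :+ f :+ n := a :+ n :+ b :+ c :+ d :+ e :+ f) refl

module Representations {m₁} (G₁ : Gram m₁) (L₁-even : IsEvenLattice G₁) (N : ℤ)
  {p} (prime-p : Prime p) (ν : ℕ)
  (γ : Fin (m₁ + 2) → ℚ) (γ-dual : InDual (gramSum G₁ N) γ) (n : ℚ) where

  open DirectSum G₁ N
  open IsEvenLattice L₁-even using () renaming (symmetric to sym-G₁; evenDiag to even-G₁)
  open TwoVariable prime-p ν N using (q; form; count)
  private instance _ = prime⇒nonZero prime-p

  IsSolution : (Fin (m₁ + 2) → Fin q) → Bool
  IsSolution r = zeroMod q (Qform G (embedFin r -ᵥ γ) ℚ.+ n)

  IsSolution-ext : Extensional IsSolution
  IsSolution-ext r r′ r≗r′ = cong (λ x → zeroMod q (x ℚ.+ n))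
    (Qform-cong G (λ i → cong (λ f → ℤ→ℚ (+ toℕ f) ℚ.- γ i) (r≗r′ i)))

  repNum≡sumVec : repNum G γ n q ≡ sumVec (m₁ + 2) q (𝟙 ∘ IsSolution)
  repNum≡sumVec = countᵇ-allVecs (m₁ + 2) q IsSolution IsSolution-ext

  module Around (r₀ : Fin (m₁ + 2) → Fin q) (r₀-sol : IsSolution r₀ ≡ true) where

    A : Fin (m₁ + 2) → ℚ
    A = embedFin r₀ -ᵥ γ

    private
      QA+n = zeroMod-sound q (Qform G A ℚ.+ n) r₀-sol
      z₀ = proj₁ QA+n

      embedℤ-++ : ∀ (u : Fin m₁ → ℤ) (v : Fin 2 → ℤ) {u′ v′} →
        (∀ k → ℤ→ℚ (u k) ≡ u′ k) → (∀ b → ℤ→ℚ (v b) ≡ v′ b) →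
        ∀ i → embedℤ (u V.++ v) i ≡ (u′ V.++ v′) i
      embedℤ-++ u v hu hv i with splitAt m₁ i
      ... | inj₁ k = hu k
      ... | inj₂ b = hv b

      bil-A-isInt : ∀ x → IsInt (bil G A (embedℤ x))
      bil-A-isInt x = isInt-resp (sym (bil-subˡ G (embedFin r₀) γ (embedℤ x)))
        (isInt-- (isInt-sumFin² G (embedFin r₀) (embedℤ x)
                   (λ i → isInt-ℤ→ℚ (+ toℕ (r₀ i))) (λ i → isInt-ℤ→ℚ (x i)))
                 (γ-dual x))

      B₁-int : IsInt (bil G A e₁)
      B₁-int = isInt-resp
        (bil-cong G (λ _ → refl) (embedℤ-++ (λ _ → + 0) (+ 1 V.∷ + 0 V.∷ V.[])
          (λ _ → refl) (λ { zero → refl ; (suc zero) → refl })))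
        (bil-A-isInt ((λ _ → + 0) V.++ (+ 1 V.∷ + 0 V.∷ V.[])))

      B₂-int : IsInt (bil G A e₂)
      B₂-int = isInt-resp
        (bil-cong G (λ _ → refl) (embedℤ-++ (λ _ → + 0) (+ 0 V.∷ + 1 V.∷ V.[])
          (λ _ → refl) (λ { zero → refl ; (suc zero) → refl })))
        (bil-A-isInt ((λ _ → + 0) V.++ (+ 0 V.∷ + 1 V.∷ V.[])))

    B₁ B₂ : ℤ
    B₁ = proj₁ B₁-int
    B₂ = proj₁ B₂-int

    x₀ y₀ : ℕ
    x₀ = toℕ (r₀ (m₁ ↑ʳ zero))
    y₀ = toℕ (r₀ (m₁ ↑ʳ suc zero))

    w₀ : Fin m₁ → Fin q
    w₀ k = r₀ (k ↑ˡ 2)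

    -- For w = w₀ + p^ℓ u, the constant term is c = (Q(r₀ - γ) + n) + p^ℓ B(r₀ - γ, u) + p^(2ℓ) Q(u).
    near-solution : ∀ ℓ → ℓ ≤ ν → (w : Fin m₁ → Fin q) →
      (∀ k → + (p ^ ℓ) ℤ∣.∣ (+ toℕ (w k) ℤ.- + toℕ (w₀ k))) →
      ∃ λ c → + (p ^ ℓ) ℤ∣.∣ c ×
        ∀ x y → IsSolution (w V.++ (x V.∷ y V.∷ V.[])) ≡ q ∣ᵇ form B₁ B₂ x₀ y₀ c (toℕ x) (toℕ y)
    near-solution ℓ ℓ≤ν w p^ℓ∣ = c , p^ℓ∣c , solution≡
      where
      P = + (p ^ ℓ)
      u : Fin m₁ → ℤ
      u k = ℤ∣.quotient (p^ℓ∣ k)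
      w-w₀≡ : ∀ k → + toℕ (w k) ℤ.- + toℕ (w₀ k) ≡ P ℤ.* u k
      w-w₀≡ k = trans (ℤ∣._∣_.equality (p^ℓ∣ k)) (ℤP.*-comm (u k) P)
      U : Fin (m₁ + 2) → ℚ
      U = (ℤ→ℚ ∘ u) V.++ 0ᵥ {2}
      U-embed : ∀ i → embedℤ (u V.++ (λ _ → + 0)) i ≡ U i
      U-embed = embedℤ-++ u (λ _ → + 0) (λ _ → refl) (λ _ → refl)
      j₁-int = isInt-resp (bil-cong G (λ _ → refl) U-embed) (bil-A-isInt (u V.++ (λ _ → + 0)))
      j₂-int = Qform-isInt G (gramSum-sym sym-G₁) (gramSum-even even-G₁) U
        (λ i → isInt-resp (U-embed i) (isInt-ℤ→ℚ ((u V.++ (λ _ → + 0)) i)))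
      j₁ = proj₁ j₁-int
      j₂ = proj₁ j₂-int
      c = z₀ ℤ.+ P ℤ.* j₁ ℤ.+ (P ℤ.* P) ℤ.* j₂
      p^ℓ∣c : P ℤ∣.∣ c
      p^ℓ∣c = ℤ∣.∣m∣n⇒∣m+n (ℤ∣.∣m∣n⇒∣m+n (ℤ∣.∣-trans (p^-∣-p^ prime-p ℓ≤ν) (proj₂ (proj₂ QA+n)))
                                         (ℤ∣.∣m⇒∣m*n j₁ ℤ∣.∣-refl))
                       (ℤ∣.∣m⇒∣m*n j₂ (ℤ∣.∣m⇒∣m*n P ℤ∣.∣-refl))
      solution≡ : ∀ x y → IsSolution (w V.++ (x V.∷ y V.∷ V.[])) ≡
        q ∣ᵇ form B₁ B₂ x₀ y₀ c (toℕ x) (toℕ y)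
      solution≡ x y = trans (cong (zeroMod q) Q≡) (zeroMod-ℤ→ℚ q _)
        where
        s = + toℕ x ℤ.- + x₀
        t = + toℕ y ℤ.- + y₀
        P′ = ℤ→ℚ P
        s′ = ℤ→ℚ s
        t′ = ℤ→ℚ t

        poly : ℚ → ℚ → ℚ → ℚ → ℚ → ℚ
        poly a b c d e = a ℚ.+ P′ ℚ.* b ℚ.+ (P′ ℚ.* P′) ℚ.* c ℚ.+ s′ ℚ.* d ℚ.+ t′ ℚ.* e
          ℚ.+ ℤ→ℚ N ℚ.* s′ ℚ.* t′

        poly-cong : ∀ {a a′ b b′ c c′ d d′ e e′} → a ≡ a′ → b ≡ b′ → c ≡ c′ → d ≡ d′ → e ≡ e′ →
          poly a b c d e ≡ poly a′ b′ c′ d′ e′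
        poly-cong refl refl refl refl refl = refl

        ℤ→ℚ-form : ℤ→ℚ (form B₁ B₂ x₀ y₀ c (toℕ x) (toℕ y)) ≡
          poly (ℤ→ℚ z₀) (ℤ→ℚ j₁) (ℤ→ℚ j₂) (ℤ→ℚ B₁) (ℤ→ℚ B₂)
        ℤ→ℚ-form = begin
          ℤ→ℚ (c ℤ.+ s ℤ.* B₁ ℤ.+ t ℤ.* B₂ ℤ.+ N ℤ.* s ℤ.* t)
            ≡⟨ ℤ→ℚ-+ (c ℤ.+ s ℤ.* B₁ ℤ.+ t ℤ.* B₂) (N ℤ.* s ℤ.* t) ⟩
          ℤ→ℚ (c ℤ.+ s ℤ.* B₁ ℤ.+ t ℤ.* B₂) ℚ.+ ℤ→ℚ (N ℤ.* s ℤ.* t)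
            ≡⟨ cong₂ ℚ._+_ (trans (ℤ→ℚ-+ (c ℤ.+ s ℤ.* B₁) (t ℤ.* B₂)) (cong₂ ℚ._+_ (ℤ→ℚ-+ c (s ℤ.* B₁)) (ℤ→ℚ-* t B₂)))
                           (trans (ℤ→ℚ-* (N ℤ.* s) t) (cong (ℚ._* t′) (ℤ→ℚ-* N s))) ⟩
          ℤ→ℚ c ℚ.+ ℤ→ℚ (s ℤ.* B₁) ℚ.+ t′ ℚ.* ℤ→ℚ B₂ ℚ.+ ℤ→ℚ N ℚ.* s′ ℚ.* t′
            ≡⟨ cong (λ z → z ℚ.+ t′ ℚ.* ℤ→ℚ B₂ ℚ.+ ℤ→ℚ N ℚ.* s′ ℚ.* t′)
                 (cong₂ ℚ._+_ c≡ (ℤ→ℚ-* s B₁)) ⟩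
          poly (ℤ→ℚ z₀) (ℤ→ℚ j₁) (ℤ→ℚ j₂) (ℤ→ℚ B₁) (ℤ→ℚ B₂) ∎
          where
          open ≡-Reasoning
          c≡ : ℤ→ℚ c ≡ ℤ→ℚ z₀ ℚ.+ P′ ℚ.* ℤ→ℚ j₁ ℚ.+ (P′ ℚ.* P′) ℚ.* ℤ→ℚ j₂
          c≡ = trans (ℤ→ℚ-+ (z₀ ℤ.+ P ℤ.* j₁) ((P ℤ.* P) ℤ.* j₂))
            (cong₂ ℚ._+_ (trans (ℤ→ℚ-+ z₀ (P ℤ.* j₁)) (cong (ℤ→ℚ z₀ ℚ.+_) (ℤ→ℚ-* P j₁)))
                         (trans (ℤ→ℚ-* (P ℤ.* P) j₂) (cong (ℚ._* ℤ→ℚ j₂) (ℤ→ℚ-* P P))))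

        Q≡ : Qform G (embedFin (w V.++ (x V.∷ y V.∷ V.[])) -ᵥ γ) ℚ.+ n ≡
          ℤ→ℚ (form B₁ B₂ x₀ y₀ c (toℕ x) (toℕ y))
        Q≡ = begin
          Qform G (embedFin (w V.++ (x V.∷ y V.∷ V.[])) -ᵥ γ) ℚ.+ n
            ≡⟨ cong (ℚ._+ n) (trans (Qform-cong G (embedFin-++≡+shift r₀ w x y γ P u w-w₀≡))
                 (Qform-+-shift sym-G₁ A P′ (ℤ→ℚ ∘ u) s′ t′)) ⟩
          poly (Qform G A) (bil G A U) (Qform G U) (bil G A e₁) (bil G A e₂) ℚ.+ n
            ≡⟨ +-move-last (Qform G A) _ _ _ _ _ n ⟩
          poly (Qform G A ℚ.+ n) (bil G A U) (Qform G U) (bil G A e₁) (bil G A e₂)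
            ≡⟨ poly-cong (proj₁ (proj₂ QA+n)) (proj₂ j₁-int) (proj₂ j₂-int) (proj₂ B₁-int) (proj₂ B₂-int) ⟩
          poly (ℤ→ℚ z₀) (ℤ→ℚ j₁) (ℤ→ℚ j₂) (ℤ→ℚ B₁) (ℤ→ℚ B₂)
            ≡⟨ sym ℤ→ℚ-form ⟩
          ℤ→ℚ (form B₁ B₂ x₀ y₀ c (toℕ x) (toℕ y)) ∎
          where open ≡-Reasoning

    solutions-near : ∀ ℓ → ℓ ≤ ν → ∀ K → (∀ c → + (p ^ ℓ) ℤ∣.∣ c → K ≤ count B₁ B₂ x₀ y₀ c) →
      (p ^ (ν ∸ ℓ)) ^ m₁ * K ≤ repNum G γ n q
    solutions-near ℓ ℓ≤ν K K≤count = begin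
      (p ^ (ν ∸ ℓ)) ^ m₁ * K
        ≤⟨ sumVec-≥ m₁ q (p ^ (ν ∸ ℓ)) K congruent _ coordinate-count admissible ⟩
      sumVec m₁ q (λ w → sumVec 2 q (λ z → 𝟙 (IsSolution (w V.++ z))))
        ≡⟨ sumVec-++ m₁ 2 q (𝟙 ∘ IsSolution) (λ r r′ r≗r′ → cong 𝟙 (IsSolution-ext r r′ r≗r′)) ⟨
      sumVec (m₁ + 2) q (𝟙 ∘ IsSolution)
        ≡⟨ repNum≡sumVec ⟨
      repNum G γ n q ∎
      where
      open ℕP.≤-Reasoning
      open ℤ-Solver using (solve; _:=_; _:+_; _:*_; :-_; _:-_; con)
      congruent : Fin m₁ → Fin q → Bool
      congruent k x = p ^ ℓ ∣ᵇ (+ toℕ x ℤ.- + toℕ (w₀ k))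

      coordinate-count : ∀ k → p ^ (ν ∸ ℓ) ≤ sumFinℕ q (𝟙 ∘ congruent k)
      coordinate-count k = ℕP.≤-reflexive (sym (begin-equality
        sumFinℕ q (𝟙 ∘ congruent k)
          ≡⟨ sumFinℕ-toℕ q (λ x → 𝟙 (p ^ ℓ ∣ᵇ (+ x ℤ.- + toℕ (w₀ k)))) ⟩
        sumRange q (λ x → 𝟙 (p ^ ℓ ∣ᵇ (+ x ℤ.- + toℕ (w₀ k))))
          ≡⟨ sumRange-cong q (λ x → cong (𝟙 ∘ (p ^ ℓ ∣ᵇ_)) (sym (solve 2 (λ x w →
               x :* con (+ 1) :+ :- w := x :- w)
               refl (+ x) (+ toℕ (w₀ k))))) ⟩
        sumRange q (λ x → 𝟙 (p ^ ℓ ∣ᵇ (+ x ℤ.* + 1 ℤ.+ ℤ.- + toℕ (w₀ k))))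
          ≡⟨ linear-congruence-count prime-p ν ℓ 0 z≤n ℓ≤ν (prime∤1 prime-p)
               (sym (ℤP.*-identityˡ (+ 1))) (sym (ℤP.*-identityˡ _)) ⟩
        p ^ (ν ∸ ℓ + 0)
          ≡⟨ cong (p ^_) (ℕP.+-identityʳ (ν ∸ ℓ)) ⟩
        p ^ (ν ∸ ℓ) ∎))

      admissible : ∀ w → (∀ k → congruent k (w k) ≡ true) →
        K ≤ sumVec 2 q (λ z → 𝟙 (IsSolution (w V.++ z)))
      admissible w w-congruent = ℕP.≤-trans (K≤count c p^ℓ∣c) (ℕP.≤-reflexive (sym (begin-equality
        sumFinℕ q (λ x → sumFinℕ q (λ y → 𝟙 (IsSolution (w V.++ consF x (consF y (λ ()))))))
          ≡⟨ sumFinℕ-cong {q} (λ x → sumFinℕ-cong {q} (λ y → cong 𝟙 (trans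
               (IsSolution-ext _ _ (VP.++-cong w w (λ _ → refl) (pair≗ x y))) (solution≡ x y)))) ⟩
        sumFinℕ q (λ x → sumFinℕ q (λ y → 𝟙 (q ∣ᵇ form B₁ B₂ x₀ y₀ c (toℕ x) (toℕ y))))
          ≡⟨ sumFinℕ-cong {q} (λ x → sumFinℕ-toℕ q (λ y → 𝟙 (q ∣ᵇ form B₁ B₂ x₀ y₀ c (toℕ x) y))) ⟩
        sumFinℕ q (λ x → sumRange q (λ y → 𝟙 (q ∣ᵇ form B₁ B₂ x₀ y₀ c (toℕ x) y)))
          ≡⟨ sumFinℕ-toℕ q (λ x → sumRange q (λ y → 𝟙 (q ∣ᵇ form B₁ B₂ x₀ y₀ c x y))) ⟩
        count B₁ B₂ x₀ y₀ c ∎)))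
        where
        near = near-solution ℓ ℓ≤ν w (λ k → ∣ᵇ-sound (w-congruent k))
        c = proj₁ near
        p^ℓ∣c = proj₁ (proj₂ near)
        solution≡ = proj₂ (proj₂ near)
        pair≗ : ∀ x y i → consF x (consF y (λ ())) i ≡ (x V.∷ y V.∷ V.[]) i
        pair≗ x y zero = refl
        pair≗ x y (suc zero) = refl

    bound-from-solution : ∀ e → e ≤ ν → + (p ^ e) ℤ∣.∣ N → (e < ν → ¬ + (p ^ suc e) ℤ∣.∣ N) →
      ∃ λ ℓ → ℓ ≤ e × ∃ λ K → p ^ (ν + e) * (p ∸ 1) ≤ p ^ suc (e ∸ ℓ) * K ×
        (p ^ (ν ∸ ℓ)) ^ m₁ * K ≤ repNum G γ n q
    bound-from-solution e e≤ν p^e∣N p^e⁺¹∤N =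
      add-L₁ (TwoVariable.two-variable-bound prime-p ν N B₁ B₂ x₀ y₀ e e≤ν p^e∣N p^e⁺¹∤N)
      where
      add-L₁ : (∃ λ ℓ → ℓ ≤ e × ∃ λ K → p ^ (ν + e) * (p ∸ 1) ≤ p ^ suc (e ∸ ℓ) * K ×
                 (∀ c → + (p ^ ℓ) ℤ∣.∣ c → K ≤ count B₁ B₂ x₀ y₀ c)) →
               ∃ λ ℓ → ℓ ≤ e × ∃ λ K → p ^ (ν + e) * (p ∸ 1) ≤ p ^ suc (e ∸ ℓ) * K ×
                 (p ^ (ν ∸ ℓ)) ^ m₁ * K ≤ repNum G γ n q
      add-L₁ (ℓ , ℓ≤e , K , two-variable , K≤count) =
        ℓ , ℓ≤e , K , two-variable , solutions-near ℓ (ℕP.≤-trans ℓ≤e e≤ν) K K≤count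

  repNum-bound : 0 < repNum G γ n q →
    ∀ e → e ≤ ν → + (p ^ e) ℤ∣.∣ N → (e < ν → ¬ + (p ^ suc e) ℤ∣.∣ N) →
    ∃ λ ℓ → ℓ ≤ e × ∃ λ K → p ^ (ν + e) * (p ∸ 1) ≤ p ^ suc (e ∸ ℓ) * K ×
      (p ^ (ν ∸ ℓ)) ^ m₁ * K ≤ repNum G γ n q
  repNum-bound R>0 = from-solution (sumVec-positive (𝟙 ∘ IsSolution) (subst (0 <_) repNum≡sumVec R>0))
    where
    from-solution : (∃ λ r₀ → 0 < 𝟙 (IsSolution r₀)) →
      ∀ e → e ≤ ν → + (p ^ e) ℤ∣.∣ N → (e < ν → ¬ + (p ^ suc e) ℤ∣.∣ N) →
      ∃ λ ℓ → ℓ ≤ e × ∃ λ K → p ^ (ν + e) * (p ∸ 1) ≤ p ^ suc (e ∸ ℓ) * K ×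
        (p ^ (ν ∸ ℓ)) ^ m₁ * K ≤ repNum G γ n q
    from-solution (r₀ , r₀-sol) = Around.bound-from-solution r₀ (𝟙-positive r₀-sol)

module _ where
  open +-*-Solver

  private
    exponent-collect : ∀ a ν νN → ν * (a + 2) ≤ (ν ∸ νN ⊓ ν) * suc a + a * νN + (ν + νN ⊓ ν)
    exponent-collect a ν νN with ℕP.≤-total νN ν
    ... | inj₁ νN≤ν rewrite ℕP.m≤n⇒m⊓n≡m νN≤ν with ℕP.m≤n⇒∃[o]m+o≡n νN≤ν
    ...   | b , refl rewrite ℕP.m+n∸m≡n νN b = ℕP.≤-reflexive
      (solve 3 (λ a e b → (e :+ b) :* (a :+ con 2) := b :* (con 1 :+ a) :+ a :* e :+ ((e :+ b) :+ e))
        refl a νN b)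
    exponent-collect a ν νN | inj₂ ν≤νN rewrite ℕP.m≥n⇒m⊓n≡n ν≤νN | ℕP.n∸n≡0 ν = begin
      ν * (a + 2)         ≡⟨ solve 2 (λ ν a → ν :* (a :+ con 2) := a :* ν :+ (ν :+ ν)) refl ν a ⟩
      a * ν + (ν + ν)     ≤⟨ ℕP.+-monoˡ-≤ (ν + ν) (ℕP.*-monoʳ-≤ a ν≤νN) ⟩
      a * νN + (ν + ν)    ∎
      where open ℕP.≤-Reasoning

    exponent-trade : ∀ a ν e ℓ → ℓ ≤ e → e ≤ ν → (ν ∸ e) * suc a + (e ∸ ℓ) ≤ (ν ∸ ℓ) * suc a
    exponent-trade a ν e ℓ ℓ≤e e≤ν with ℕP.m≤n⇒∃[o]m+o≡n ℓ≤e | ℕP.m≤n⇒∃[o]m+o≡n e≤ν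
    ... | b , refl | c , refl
      rewrite ℕP.m+n∸m≡n (ℓ + b) c | ℕP.m+n∸m≡n ℓ b | ℕP.+-assoc ℓ b c | ℕP.m+n∸m≡n ℓ (b + c) = begin
      c * suc a + b                ≤⟨ ℕP.+-monoʳ-≤ (c * suc a) (ℕP.m≤m*n b (suc a)) ⟩
      c * suc a + b * suc a        ≡⟨ solve 3 (λ a b c → c :* a :+ b :* a := (b :+ c) :* a) refl (suc a) b c ⟩
      (b + c) * suc a              ∎
      where open ℕP.≤-Reasoning

  count-bound : ∀ p .{{_ : NonZero p}} a ν νN R →
    (∃ λ ℓ → ℓ ≤ νN ⊓ ν × ∃ λ K → p ^ (ν + νN ⊓ ν) * (p ∸ 1) ≤ p ^ suc (νN ⊓ ν ∸ ℓ) * K ×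
      (p ^ (ν ∸ ℓ)) ^ suc a * K ≤ R) →
    p ^ (ν * (a + 2)) * (p ∸ 1) ≤ R * (p ^ (a * νN) * p)
  count-bound p a ν νN R (ℓ , ℓ≤e , K , two-variable , R-bound) = begin
    p ^ (ν * (a + 2)) * (p ∸ 1)
      ≤⟨ ℕP.*-monoˡ-≤ (p ∸ 1) (ℕP.^-monoʳ-≤ p (exponent-collect a ν νN)) ⟩
    p ^ (X + (ν + e)) * (p ∸ 1)
      ≡⟨ trans (cong (_* (p ∸ 1)) (ℕP.^-distribˡ-+-* p X (ν + e))) (ℕP.*-assoc (p ^ X) _ (p ∸ 1)) ⟩
    p ^ X * (p ^ (ν + e) * (p ∸ 1))
      ≤⟨ ℕP.*-monoʳ-≤ (p ^ X) two-variable ⟩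
    p ^ X * (p * p ^ (e ∸ ℓ) * K)
      ≡⟨ cong (_* (p * p ^ (e ∸ ℓ) * K)) (ℕP.^-distribˡ-+-* p ((ν ∸ e) * suc a) (a * νN)) ⟩
    p ^ ((ν ∸ e) * suc a) * p ^ (a * νN) * (p * p ^ (e ∸ ℓ) * K)
      ≡⟨ solve 5 (λ x y p z k → x :* y :* (p :* z :* k) := y :* p :* (x :* z :* k))
           refl (p ^ ((ν ∸ e) * suc a)) (p ^ (a * νN)) p (p ^ (e ∸ ℓ)) K ⟩
    p ^ (a * νN) * p * (p ^ ((ν ∸ e) * suc a) * p ^ (e ∸ ℓ) * K)
      ≡⟨ cong (λ z → p ^ (a * νN) * p * (z * K)) (sym (ℕP.^-distribˡ-+-* p ((ν ∸ e) * suc a) (e ∸ ℓ))) ⟩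
    p ^ (a * νN) * p * (p ^ ((ν ∸ e) * suc a + (e ∸ ℓ)) * K)
      ≤⟨ ℕP.*-monoʳ-≤ (p ^ (a * νN) * p) (ℕP.*-monoˡ-≤ K
           (ℕP.^-monoʳ-≤ p (exponent-trade a ν e ℓ ℓ≤e (ℕP.m⊓n≤n νN ν)))) ⟩
    p ^ (a * νN) * p * (p ^ ((ν ∸ ℓ) * suc a) * K)
      ≡⟨ cong (λ z → p ^ (a * νN) * p * (z * K)) (sym (ℕP.^-*-assoc p (ν ∸ ℓ) (suc a))) ⟩
    p ^ (a * νN) * p * ((p ^ (ν ∸ ℓ)) ^ suc a * K)
      ≤⟨ ℕP.*-monoʳ-≤ (p ^ (a * νN) * p) R-bound ⟩
    p ^ (a * νN) * p * R
      ≡⟨ ℕP.*-comm (p ^ (a * νN) * p) R ⟩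
    R * (p ^ (a * νN) * p) ∎
    where
    open ℕP.≤-Reasoning
    e = νN ⊓ ν
    X = (ν ∸ e) * suc a + a * νN

module _ where
  private
    toℚᵘ-1/ : ∀ D .{{_ : NonZero D}} → ℚ.toℚᵘ ((+ 1) ℚ./ D) ≡ mkℚᵘ (+ 1) (pred D)
    toℚᵘ-1/ (suc d) = cong ℚ.toℚᵘ (ℚP.normalize-coprime {1} {d} (Coprime.1-coprimeTo (suc d)))

    toℚᵘ-/1 : ∀ c → ℚ.toℚᵘ ((+ c) ℚ./ 1) ≡ mkℚᵘ (+ c) 0
    toℚᵘ-/1 c = cong ℚ.toℚᵘ (ℚP.normalize-coprime {c} {0} (Coprime.sym (Coprime.1-coprimeTo c)))

    toℚᵘ-powℤ-neg : ∀ p′ k → ℚ.toℚᵘ (powℤ (suc p′) (ℤ.- + k)) ≡ mkℚᵘ (+ 1) (pred (suc p′ ^ k))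
    toℚᵘ-powℤ-neg p′ zero    = toℚᵘ-/1 1
    toℚᵘ-powℤ-neg p′ (suc k) = toℚᵘ-1/ (suc p′ ^ suc k) {{ℕP.m^n≢0 (suc p′) (suc k)}}

    -- Cross-multiplied form of (1/D₁)(1 - 1/Dₚ) ≤ c/D₂ with D = suc d.
    ℚᵘ-bound : ∀ d₁ dₚ d₂ c → dₚ * suc d₂ ≤ c * (suc d₁ * suc dₚ) →
      mkℚᵘ (+ 1) d₁ ℚᵘ.* (mkℚᵘ (+ 1) 0 ℚᵘ.+ ℚᵘ.- mkℚᵘ (+ 1) dₚ) ℚᵘ.≤ mkℚᵘ (+ 1) d₂ ℚᵘ.* mkℚᵘ (+ c) 0
    ℚᵘ-bound d₁ dₚ d₂ c h = ℚᵘ.*≤* (subst₂ ℤ._≤_ (sym lhs) (sym rhs) (ℤ.+≤+ h))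
      where
      open ℤ-Solver
      lhs : (+ 1 ℤ.* (+ 1 ℤ.* + suc dₚ ℤ.+ ℤ.- (+ 1) ℤ.* + 1)) ℤ.* + (suc d₂ * 1) ≡ + (dₚ * suc d₂)
      lhs = trans (cong ((+ 1 ℤ.* (+ 1 ℤ.* + suc dₚ ℤ.+ ℤ.- (+ 1) ℤ.* + 1)) ℤ.*_) (ℤP.pos-* (suc d₂) 1))
        (trans (solve 2 (λ a b → (con (+ 1) :* (con (+ 1) :* (con (+ 1) :+ a) :+ :- con (+ 1) :* con (+ 1)))
                                  :* ((con (+ 1) :+ b) :* con (+ 1)) := a :* (con (+ 1) :+ b)) refl (+ dₚ) (+ d₂))
          (sym (ℤP.pos-* dₚ (suc d₂))))
      rhs : (+ 1 ℤ.* + c) ℤ.* + (suc d₁ * (1 * suc dₚ)) ≡ + (c * (suc d₁ * suc dₚ))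
      rhs = trans (cong ((+ 1 ℤ.* + c) ℤ.*_)
                    (trans (ℤP.pos-* (suc d₁) (1 * suc dₚ)) (cong (+ suc d₁ ℤ.*_) (ℤP.pos-* 1 (suc dₚ)))))
        (trans (solve 3 (λ c a b → (con (+ 1) :* c) :* ((con (+ 1) :+ a) :* (con (+ 1) :* (con (+ 1) :+ b)))
                                   := c :* ((con (+ 1) :+ a) :* (con (+ 1) :+ b))) refl (+ c) (+ d₁) (+ dₚ))
          (sym (trans (ℤP.pos-* c (suc d₁ * suc dₚ)) (cong (+ c ℤ.*_) (ℤP.pos-* (suc d₁) (suc dₚ))))))

  powℤ-neg-bound : ∀ p′ k₁ k₂ c → suc p′ ^ k₂ * p′ ≤ c * (suc p′ ^ k₁ * suc p′) →
    powℤ (suc p′) (ℤ.- + k₁) ℚ.* (1ℚ ℚ.- powℤ (suc p′) -[1+ 0 ])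
      ℚ.≤ powℤ (suc p′) (ℤ.- + k₂) ℚ.* ((+ c) ℚ./ 1)
  powℤ-neg-bound p′ k₁ k₂ c h = ℚP.toℚᵘ-cancel-≤
    (ℚᵘP.≤-respʳ-≃ (ℚᵘP.≃-sym rhs≃) (ℚᵘP.≤-respˡ-≃ (ℚᵘP.≃-sym lhs≃)
      (ℚᵘ-bound (pred (P ^ k₁)) (p′ * 1) (pred (P ^ k₂)) c h′)))
    where
    P = suc p′
    instance
      _ = ℕP.m^n≢0 P k₁
      _ = ℕP.m^n≢0 P k₂
    h′ : p′ * 1 * suc (pred (P ^ k₂)) ≤ c * (suc (pred (P ^ k₁)) * suc (p′ * 1))
    h′ = subst₂ _≤_ (cong₂ _*_ (sym (ℕP.*-identityʳ p′)) (sym (ℕP.suc-pred (P ^ k₂))))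
      (cong (c *_) (cong₂ _*_ (sym (ℕP.suc-pred (P ^ k₁))) (cong suc (sym (ℕP.*-identityʳ p′)))))
      (subst (_≤ c * (P ^ k₁ * P)) (ℕP.*-comm (P ^ k₂) p′) h)
    lhs≃ : ℚ.toℚᵘ (powℤ P (ℤ.- + k₁) ℚ.* (1ℚ ℚ.- powℤ P -[1+ 0 ])) ℚᵘ.≃
      mkℚᵘ (+ 1) (pred (P ^ k₁)) ℚᵘ.* (mkℚᵘ (+ 1) 0 ℚᵘ.+ ℚᵘ.- mkℚᵘ (+ 1) (p′ * 1))
    lhs≃ = ℚᵘP.≃-trans (ℚP.toℚᵘ-homo-* (powℤ P (ℤ.- + k₁)) (1ℚ ℚ.- powℤ P -[1+ 0 ]))
      (ℚᵘP.*-cong (ℚᵘP.≃-reflexive (toℚᵘ-powℤ-neg p′ k₁))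
        (ℚᵘP.≃-trans (ℚP.toℚᵘ-homo-+ 1ℚ (ℚ.- powℤ P -[1+ 0 ]))
          (ℚᵘP.+-cong (ℚᵘP.≃-refl {mkℚᵘ (+ 1) 0})
            (ℚᵘP.≃-trans (ℚP.toℚᵘ-homo‿- (powℤ P -[1+ 0 ]))
              (ℚᵘP.-‿cong (ℚᵘP.≃-reflexive (toℚᵘ-powℤ-neg p′ 1)))))))
    rhs≃ : ℚ.toℚᵘ (powℤ P (ℤ.- + k₂) ℚ.* ((+ c) ℚ./ 1)) ℚᵘ.≃
      mkℚᵘ (+ 1) (pred (P ^ k₂)) ℚᵘ.* mkℚᵘ (+ c) 0
    rhs≃ = ℚᵘP.≃-trans (ℚP.toℚᵘ-homo-* (powℤ P (ℤ.- + k₂)) ((+ c) ℚ./ 1))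
      (ℚᵘP.*-cong (ℚᵘP.≃-reflexive (toℚᵘ-powℤ-neg p′ k₂)) (ℚᵘP.≃-reflexive (toℚᵘ-/1 c)))

module _ where
  open ℤ-Solver

  exponent-νN : ∀ a νN → (+ 3 ℤ.- + (suc a + 2)) ℤ.* + νN ≡ ℤ.- + (a * νN)
  exponent-νN a νN = trans (cong (λ z → (+ 3 ℤ.- z) ℤ.* + νN) (ℤP.pos-+ (suc a) 2))
    (trans (solve 2 (λ a n → (con (+ 3) :- ((con (+ 1) :+ a) :+ con (+ 2))) :* n := :- (a :* n)) refl (+ a) (+ νN))
      (cong ℤ.-_ (sym (ℤP.pos-* a νN))))

  exponent-ν : ∀ a ν → + ν ℤ.* (+ 1 ℤ.- + (suc a + 2)) ≡ ℤ.- + (ν * (a + 2))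
  exponent-ν a ν = trans (cong (λ z → + ν ℤ.* (+ 1 ℤ.- z)) (ℤP.pos-+ (suc a) 2))
    (trans (solve 2 (λ a n → n :* (con (+ 1) :- ((con (+ 1) :+ a) :+ con (+ 2))) := :- (n :* (a :+ con (+ 2))))
      refl (+ a) (+ ν))
      (cong ℤ.-_ (sym (trans (ℤP.pos-* ν (a + 2)) (cong (+ ν ℤ.*_) (ℤP.pos-+ a 2))))))

-- The right-hand disjunct of the theorem for p = p′ + 1 and m = a + 3.
Bound : (p′ a ν νN R : ℕ) → Set
Bound p′ a ν νN R = powℤ (suc p′) ((+ 3 ℤ.- + (suc a + 2)) ℤ.* + νN) ℚ.* (1ℚ ℚ.- powℤ (suc p′) -[1+ 0 ])
  ℚ.≤ powℤ (suc p′) (+ ν ℤ.* (+ 1 ℤ.- + (suc a + 2))) ℚ.* ((+ R) ℚ./ 1)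

rational-bound : ∀ p′ a ν νN R → suc p′ ^ (ν * (a + 2)) * p′ ≤ R * (suc p′ ^ (a * νN) * suc p′) →
  Bound p′ a ν νN R
rational-bound p′ a ν νN R h rewrite exponent-νN a νN | exponent-ν a ν =
  powℤ-neg-bound p′ (a * νN) (ν * (a + 2)) R h

IsOrd-⊓ : ∀ {p N νN} → Prime p → ∀ ν → IsOrd p N νN →
  + (p ^ (νN ⊓ ν)) ℤ∣.∣ N × (νN ⊓ ν < ν → ¬ + (p ^ suc (νN ⊓ ν)) ℤ∣.∣ N)
IsOrd-⊓ {p} {N} {νN} prime-p ν (p^νN∣N , p^νN⁺¹∤N) =
  ℤ∣.∣-trans (p^-∣-p^ prime-p (ℕP.m⊓n≤m νN ν)) (ℤ∣.∣ᵤ⇒∣ p^νN∣N) , exact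
  where
  exact : νN ⊓ ν < ν → ¬ + (p ^ suc (νN ⊓ ν)) ℤ∣.∣ N
  exact e<ν p^e⁺¹∣N with ℕP.≤-total νN ν
  ... | inj₁ νN≤ν =
    p^νN⁺¹∤N (subst (λ k → p ^ suc k ℕ∣.∣ ℤ.∣ N ∣) (ℕP.m≤n⇒m⊓n≡m νN≤ν) (ℤ∣.∣⇒∣ᵤ p^e⁺¹∣N))
  ... | inj₂ ν≤νN = ℕP.<-irrefl (ℕP.m≥n⇒m⊓n≡n ν≤νN) e<ν

zero-or-positive : ∀ {P : ℕ → Set} R → (0 < R → P R) → R ≡ 0 ⊎ P R
zero-or-positive zero    _ = inj₁ refl
zero-or-positive (suc R) f = inj₂ (f (s≤s z≤n))

lemma3p6 : (m₁ : ℕ) (G₁ : Gram m₁) → IsEvenLattice G₁ →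
    (N : ℤ) → N ≢ + 0 → 3 ≤ m₁ + 2 →
    (p : ℕ) → Prime p → (ν : ℕ) →
    (γ : Fin (m₁ + 2) → ℚ) → InDual (gramSum G₁ N) γ →
    (n : ℚ) → IsInt (n ℚ.+ Qform (gramSum G₁ N) γ) →
    (νN : ℕ) → IsOrd p N νN →
    repNum (gramSum G₁ N) γ n (p ^ ν) ≡ 0
    ⊎ powℤ p ((+ 3 ℤ.- + (m₁ + 2)) ℤ.* + νN) ℚ.* (1ℚ ℚ.- powℤ p -[1+ 0 ])
      ℚ.≤ powℤ p (+ ν ℤ.* (+ 1 ℤ.- + (m₁ + 2))) ℚ.* ((+ repNum (gramSum G₁ N) γ n (p ^ ν)) ℚ./ 1)
lemma3p6 zero G₁ _ N _ (s≤s (s≤s ())) p _ ν γ _ n _ νN _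
lemma3p6 (suc a) G₁ _ N _ _ zero prime-p ν γ _ n _ νN _ = ⊥-elim (¬prime[0] prime-p)
lemma3p6 (suc a) G₁ L₁-even N _ _ (suc p′) prime-p ν γ γ-dual n _ νN ord-N =
  zero-or-positive {P = Bound p′ a ν νN} R λ R>0 →
    rational-bound p′ a ν νN R (count-bound (suc p′) a ν νN R
      (Representations.repNum-bound G₁ L₁-even N prime-p ν γ γ-dual n R>0 (νN ⊓ ν) (ℕP.m⊓n≤n νN ν)
        (proj₁ valuation-N) (proj₂ valuation-N)))
  where
  R = repNum (gramSum G₁ N) γ n (suc p′ ^ ν)
  valuation-N = IsOrd-⊓ prime-p ν ord-N
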